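{- Let $\mathcal N(x)=\sum_n|\mathcal N_n|x^n$, $\mathbf N(x)=\sum_{n}x^n\sum_{p\in\mathcal N_n}\overline d(p)$, $\mathcal M(x,1)=\sum_n|\mathcal M_n|x^n$ and $\mathbf M(x,1)=\sum_n x^n\sum_{p\in\mathcal M_n}\overline d(p)$. Then \[\mathbf N(x)=2x\mathbf N(x)+x^2\mathbf M(x,1)\mathcal N(x)+x^2\mathcal M(x,1)\mathbf N(x)+x^2\mathcal N(x)\tfrac{\partial}{\partial x}\big(x\mathcal M(x,1)\big)+x\mathbf N(x)+x\tfrac{\partial}{\partial x}\big(x\mathcal N(x)\big),\] and explicitly \[\mathbf N(x)=\frac{4x\left(1+\sqrt{1-4x}-x(1-\sqrt{1-4x})\right)}{\sqrt{1-4x}\,(1-4x+\sqrt{1-4x})^3}.\]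
   Context: Steps: $U=(1,1)$, $D=(1,-1)$, and two distinguishable horizontal steps $O_1,O_2$, each $(1,0)$. $\mathcal N_n$ is the set of lattice paths with $n$ steps from $\{U,D,O_1,O_2\}$ starting at $(0,0)$ and staying weakly above the $x$-axis; $\mathcal M_n\subseteq\mathcal N_n$ is the subset ending on the $x$-axis. For a path $r$ with heights $r_0,\dots,r_n$, $\overline d(r)=\sum_{i=0}^n|r_i|$. -}

module Defs where

open import Data.Nat as ℕ using (ℕ; zero; suc; _∸_)
open import Data.Integer as ℤ using (ℤ; +_; _+_; _-_; _*_; ∣_∣; _≤_)
open import Data.List using (List; []; _∷_; foldr; map; filter; length; concatMap; upTo)
open import Data.List.Relation.Unary.All using (All; all?)
open import Data.Bool using (Bool)
open import Relation.Binary.PropositionalEquality using (_≡_)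
open import Relation.Nullary using (Dec)
open import Relation.Nullary.Decidable using (⌊_⌋)

-- U = (1,1), D = (1,-1), O₁ , O₂ = two distinguishable (1,0) steps
data Step : Set where
  U D O₁ O₂ : Step

δ : Step → ℤ
δ U  = + 1
δ D  = ℤ.-[1+ 0 ]
δ O₁ = + 0
δ O₂ = + 0

heightsFrom : ℤ → List Step → List ℤ
heightsFrom h []       = h ∷ []
heightsFrom h (s ∷ ss) = h ∷ heightsFrom (h + δ s) ss

heights : List Step → List ℤ
heights = heightsFrom (+ 0)

endHeight : List Step → ℤ
endHeight = foldr (λ s h → δ s + h) (+ 0)

words : ℕ → List (List Step)
words zero    = [] ∷ []
words (suc n) = concatMap (λ w → map (λ s → s ∷ w) (U ∷ D ∷ O₁ ∷ O₂ ∷ [])) (words n)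

Nonneg : List Step → Set
Nonneg p = All (λ h → + 0 ≤ h) (heights p)

nonneg? : (p : List Step) → Dec (Nonneg p)
nonneg? p = all? (λ h → + 0 ℤ.≤? h) (heights p)

Motzkin : List Step → Set
Motzkin p = Nonneg p Data.Product.× (endHeight p ≡ + 0)
  where import Data.Product

motzkin? : (p : List Step) → Dec (Motzkin p)
motzkin? p = Relation.Nullary._×-dec_ (nonneg? p) (endHeight p ℤ.≟ + 0)
  where import Relation.Nullary

𝒩 : ℕ → List (List Step)
𝒩 n = filter nonneg? (words n)

ℳ : ℕ → List (List Step)
ℳ n = filter motzkin? (words n)

sumℤ : List ℤ → ℤ
sumℤ = foldr _+_ (+ 0)

dbar : List Step → ℤ
dbar p = sumℤ (map (λ h → + ∣ h ∣) (heights p))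

Series : Set
Series = ℕ → ℤ

infix 4 _≈ₛ_
_≈ₛ_ : Series → Series → Set
f ≈ₛ g = ∀ n → f n ≡ g n

infixl 6 _⊕_ _⊖_
infixl 7 _⊛_

_⊕_ : Series → Series → Series
(f ⊕ g) n = f n + g n

_⊖_ : Series → Series → Series
(f ⊖ g) n = f n - g n

_⊛_ : Series → Series → Series
(f ⊛ g) n = sumℤ (map (λ i → f i * g (n ∸ i)) (upTo (suc n)))

const : ℤ → Series
const c zero    = c
const c (suc n) = + 0

_·ₛ_ : ℤ → Series → Series
(c ·ₛ f) n = c * f n

X* : Series → Series
X* f zero    = + 0
X* f (suc n) = f n

∂ : Series → Series
∂ f n = + (suc n) * f (suc n)

𝒩gf : Series
𝒩gf n = + length (𝒩 n)

𝐍gf : Series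
𝐍gf n = sumℤ (map dbar (𝒩 n))

ℳgf : Series
ℳgf n = + length (ℳ n)

𝐌gf : Series
𝐌gf n = sumℤ (map dbar (ℳ n))

{-# OPTIONS --safe #-}
module Submission where

-- A word of length n + 1 is a first step followed by a word of length n.  After a U step the
-- path starts at height 1 and either never returns to the axis, or returns to it for the first
-- time by a D step preceded by a Motzkin path raised by one.  For generating functions of weighted
-- words this gives equations for ℳ, 𝒩, 𝐌 and 𝐍; the terms ∂(x ·) appear because raising a path
-- with n steps by one adds n + 1 to its area.
--
-- For the closed form let S² = 1 − 4x with S(0) = 1, and P = S(1 + S), so that 1 − 4x + S = P.
-- The ℳ-equation says (2x²ℳ + 2x − 1)² = S², and the constant terms select 2x²ℳ = 1 − 2x − S
-- (ℤ[[x]] has no zero divisors).  Then 𝒩P = 2, 𝐌S = x²ℳ ∂(xℳ), and applying the Euler operator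
-- θ = x d/dx to these identities expresses ∂(xℳ) and ∂(x𝒩) through S and θS, where S θS = −2x.
-- Substituting everything into 𝐍P = 2x²𝐌𝒩 + 2x²𝒩 ∂(xℳ) + 2x ∂(x𝒩) gives 𝐍SP³ = 4x(1 + S − x(1 − S)).

open import Defs
open import Algebra.Bundles using (CommutativeRing; RawRing)
import Algebra.Consequences.Setoid as Consequences
import Algebra.Construct.Pointwise as Pointwise
import Algebra.Solver.Ring
open import Algebra.Solver.Ring.AlmostCommutativeRing using (fromCommutativeRing; _-Raw-AlmostCommutative⟶_)
open import Algebra.Structures using (IsAbelianGroup; IsCommutativeRing)
open import Data.Integer as ℤ using (ℤ; +_; -[1+_]; _+_; _*_; -_; ∣_∣; _≤_; +≤+)
import Data.Integer.Properties as ℤP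
open import Algebra.Properties.CommutativeSemigroup ℤP.+-commutativeSemigroup using (interchange)
open import Data.Integer.Tactic.RingSolver using (solve-∀)
open import Data.List using (List; []; _∷_; _++_; map; filter; length; concatMap; applyUpTo)
open import Data.List.Relation.Unary.All using (All; []; _∷_)
open import Data.Maybe using (Maybe; just; nothing)
open import Data.Nat as ℕ using (ℕ; zero; suc; _∸_; z≤n; s≤s)
open import Data.Nat.Induction using (<-rec)
import Data.Nat.Properties as ℕP
open import Data.Product using (_×_; _,_; proj₁)
open import Data.Sum using (inj₁; inj₂)
open import Function using (_∘_; _∘′_)
open import Level using (0ℓ)
open import Relation.Binary.Bundles using (Setoid)
open import Relation.Binary.PropositionalEquality
import Relation.Binary.Reasoning.Setoid as SetoidReasoning
open import Relation.Nullary using (¬_; contradiction; yes; no)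
open import Relation.Unary using (Pred; Decidable)

-- Finite sums

∑< : ℕ → (ℕ → ℤ) → ℤ
∑< zero    f = + 0
∑< (suc n) f = f 0 + ∑< n (f ∘ suc)

∑<-cong : ∀ n {f g : ℕ → ℤ} → (∀ {i} → i ℕ.< n → f i ≡ g i) → ∑< n f ≡ ∑< n g
∑<-cong zero    eq = refl
∑<-cong (suc n) eq = cong₂ _+_ (eq (s≤s z≤n)) (∑<-cong n (eq ∘ s≤s))

∑<-zero : ∀ n {f : ℕ → ℤ} → (∀ {i} → i ℕ.< n → f i ≡ + 0) → ∑< n f ≡ + 0
∑<-zero zero    eq = refl
∑<-zero (suc n) eq = cong₂ _+_ (eq (s≤s z≤n)) (∑<-zero n (eq ∘ s≤s))

∑<-+ : ∀ n (f g : ℕ → ℤ) → ∑< n (λ i → f i + g i) ≡ ∑< n f + ∑< n g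
∑<-+ zero    f g = refl
∑<-+ (suc n) f g =
  trans (cong (_+_ (f 0 + g 0)) (∑<-+ n (f ∘ suc) (g ∘ suc))) (interchange (f 0) (g 0) _ _)

∑<-*ˡ : ∀ n c (f : ℕ → ℤ) → ∑< n (λ i → c * f i) ≡ c * ∑< n f
∑<-*ˡ zero    c f = sym (ℤP.*-zeroʳ c)
∑<-*ˡ (suc n) c f =
  trans (cong (_+_ (c * f 0)) (∑<-*ˡ n c (f ∘ suc))) (sym (ℤP.*-distribˡ-+ c (f 0) _))

∑<-last : ∀ n (f : ℕ → ℤ) → ∑< (suc n) f ≡ ∑< n f + f n
∑<-last zero    f = ℤP.+-comm (f 0) (+ 0)
∑<-last (suc n) f =
  trans (cong (_+_ (f 0)) (∑<-last n (f ∘ suc))) (sym (ℤP.+-assoc (f 0) _ _))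

∑<-reverse : ∀ n (f : ℕ → ℤ) → ∑< n f ≡ ∑< n (λ i → f (n ∸ suc i))
∑<-reverse zero    f = refl
∑<-reverse (suc n) f = begin
  f 0 + ∑< n (f ∘ suc)                    ≡⟨ cong (_+_ (f 0)) (∑<-reverse n (f ∘ suc)) ⟩
  f 0 + ∑< n (λ i → f (suc (n ∸ suc i)))  ≡⟨ ℤP.+-comm (f 0) _ ⟩
  ∑< n (λ i → f (suc (n ∸ suc i))) + f 0  ≡⟨ cong₂ _+_ (∑<-cong n (cong f ∘ sym ∘ ℕP.+-∸-assoc 1))
                                                      (cong f (sym (ℕP.n∸n≡0 n))) ⟩
  ∑< n (λ i → f (n ∸ i)) + f (n ∸ n)      ≡⟨ ∑<-last n (λ i → f (n ∸ i)) ⟨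
  ∑< (suc n) (λ i → f (n ∸ i))            ∎
  where open ≡-Reasoning

sumℤ-applyUpTo : ∀ n (g : ℕ → ℕ) (f : ℕ → ℤ) → sumℤ (map f (applyUpTo g n)) ≡ ∑< n (f ∘ g)
sumℤ-applyUpTo zero    g f = refl
sumℤ-applyUpTo (suc n) g f = cong (_+_ (f (g 0))) (sumℤ-applyUpTo n (g ∘ suc) f)

-- The ring of formal power series

0ₛ : Series
0ₛ _ = + 0

-ₛ_ : Series → Series
(-ₛ f) n = - f n

1ₛ : Series
1ₛ = const (+ 1)

x : Series
x = X* 1ₛ

tail : Series → Series
tail f n = f (suc n)

≈ₛ-refl : ∀ {f} → f ≈ₛ f
≈ₛ-refl _ = refl

⊕-cong : ∀ {f f′ g g′} → f ≈ₛ f′ → g ≈ₛ g′ → f ⊕ g ≈ₛ f′ ⊕ g′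
⊕-cong f≈f′ g≈g′ n = cong₂ _+_ (f≈f′ n) (g≈g′ n)

⊛-∑< : ∀ f g n → (f ⊛ g) n ≡ ∑< (suc n) (λ i → f i * g (n ∸ i))
⊛-∑< f g n = sumℤ-applyUpTo (suc n) (λ i → i) (λ i → f i * g (n ∸ i))

⊛-at-0 : ∀ f g → (f ⊛ g) 0 ≡ f 0 * g 0
⊛-at-0 f g = ℤP.+-identityʳ (f 0 * g 0)

⊛-at-suc : ∀ f g n → (f ⊛ g) (suc n) ≡ f 0 * g (suc n) + (tail f ⊛ g) n
⊛-at-suc f g n = trans (⊛-∑< f g (suc n)) (cong (_+_ (f 0 * g (suc n))) (sym (⊛-∑< (tail f) g n)))

⊛-cong : ∀ {f f′ g g′} → f ≈ₛ f′ → g ≈ₛ g′ → f ⊛ g ≈ₛ f′ ⊛ g′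
⊛-cong {f} {f′} {g} {g′} f≈f′ g≈g′ n = begin
  (f ⊛ g) n                             ≡⟨ ⊛-∑< f g n ⟩
  ∑< (suc n) (λ i → f i * g (n ∸ i))    ≡⟨ ∑<-cong (suc n) (λ {i} _ → cong₂ _*_ (f≈f′ i) (g≈g′ (n ∸ i))) ⟩
  ∑< (suc n) (λ i → f′ i * g′ (n ∸ i))  ≡⟨ ⊛-∑< f′ g′ n ⟨
  (f′ ⊛ g′) n                           ∎
  where open ≡-Reasoning

⊛-zeroˡ : ∀ g → 0ₛ ⊛ g ≈ₛ 0ₛ
⊛-zeroˡ g n = trans (⊛-∑< 0ₛ g n) (∑<-zero (suc n) (λ _ → refl))

const-⊛ : ∀ c g → const c ⊛ g ≈ₛ c ·ₛ g
const-⊛ c g zero    = ⊛-at-0 (const c) g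
const-⊛ c g (suc n) =
  trans (⊛-at-suc (const c) g n) (trans (cong (_+_ (c * g (suc n))) (⊛-zeroˡ g n)) (ℤP.+-identityʳ _))

·ₛ-⊛ : ∀ c f g → (c ·ₛ f) ⊛ g ≈ₛ c ·ₛ (f ⊛ g)
·ₛ-⊛ c f g n = begin
  ((c ·ₛ f) ⊛ g) n                          ≡⟨ ⊛-∑< (c ·ₛ f) g n ⟩
  ∑< (suc n) (λ i → c * f i * g (n ∸ i))    ≡⟨ ∑<-cong (suc n) (λ {i} _ → ℤP.*-assoc c (f i) (g (n ∸ i))) ⟩
  ∑< (suc n) (λ i → c * (f i * g (n ∸ i)))  ≡⟨ ∑<-*ˡ (suc n) c (λ i → f i * g (n ∸ i)) ⟩
  c * ∑< (suc n) (λ i → f i * g (n ∸ i))    ≡⟨ cong (c *_) (⊛-∑< f g n) ⟨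
  (c ·ₛ (f ⊛ g)) n                          ∎
  where open ≡-Reasoning

⊛-identityˡ : ∀ g → 1ₛ ⊛ g ≈ₛ g
⊛-identityˡ g n = trans (const-⊛ (+ 1) g n) (ℤP.*-identityˡ (g n))

⊛-distribʳ : ∀ f g h → (g ⊕ h) ⊛ f ≈ₛ g ⊛ f ⊕ h ⊛ f
⊛-distribʳ f g h n = begin
  ((g ⊕ h) ⊛ f) n
    ≡⟨ ⊛-∑< (g ⊕ h) f n ⟩
  ∑< (suc n) (λ i → (g i + h i) * f (n ∸ i))
    ≡⟨ ∑<-cong (suc n) (λ {i} _ → ℤP.*-distribʳ-+ (f (n ∸ i)) (g i) (h i)) ⟩
  ∑< (suc n) (λ i → g i * f (n ∸ i) + h i * f (n ∸ i))
    ≡⟨ ∑<-+ (suc n) (λ i → g i * f (n ∸ i)) (λ i → h i * f (n ∸ i)) ⟩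
  ∑< (suc n) (λ i → g i * f (n ∸ i)) + ∑< (suc n) (λ i → h i * f (n ∸ i))
    ≡⟨ cong₂ _+_ (⊛-∑< g f n) (⊛-∑< h f n) ⟨
  (g ⊛ f ⊕ h ⊛ f) n ∎
  where open ≡-Reasoning

⊛-comm : ∀ f g → f ⊛ g ≈ₛ g ⊛ f
⊛-comm f g n = begin
  (f ⊛ g) n                                       ≡⟨ ⊛-∑< f g n ⟩
  ∑< (suc n) (λ i → f i * g (n ∸ i))              ≡⟨ ∑<-reverse (suc n) (λ i → f i * g (n ∸ i)) ⟩
  ∑< (suc n) (λ i → f (n ∸ i) * g (n ∸ (n ∸ i)))  ≡⟨ ∑<-cong (suc n) (λ {i} i≤n → trans
                                                       (cong (λ j → f (n ∸ i) * g j) (ℕP.m∸[m∸n]≡n (ℕP.≤-pred i≤n)))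
                                                       (ℤP.*-comm (f (n ∸ i)) (g i))) ⟩
  ∑< (suc n) (λ i → g i * f (n ∸ i))              ≡⟨ ⊛-∑< g f n ⟨
  (g ⊛ f) n                                       ∎
  where open ≡-Reasoning

⊛-assoc : ∀ f g h → (f ⊛ g) ⊛ h ≈ₛ f ⊛ (g ⊛ h)
⊛-assoc f g h zero = begin
  ((f ⊛ g) ⊛ h) 0    ≡⟨ trans (⊛-at-0 (f ⊛ g) h) (cong (_* h 0) (⊛-at-0 f g)) ⟩
  f 0 * g 0 * h 0    ≡⟨ ℤP.*-assoc (f 0) (g 0) (h 0) ⟩
  f 0 * (g 0 * h 0)  ≡⟨ trans (⊛-at-0 f (g ⊛ h)) (cong (f 0 *_) (⊛-at-0 g h)) ⟨
  (f ⊛ (g ⊛ h)) 0    ∎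
  where open ≡-Reasoning
⊛-assoc f g h (suc n) = begin
  ((f ⊛ g) ⊛ h) (suc n)
    ≡⟨ ⊛-at-suc (f ⊛ g) h n ⟩
  (f ⊛ g) 0 * h (suc n) + (tail (f ⊛ g) ⊛ h) n
    ≡⟨ cong₂ _+_ (cong (_* h (suc n)) (⊛-at-0 f g)) (⊛-cong {g = h} (⊛-at-suc f g) ≈ₛ-refl n) ⟩
  f 0 * g 0 * h (suc n) + ((f 0 ·ₛ tail g ⊕ tail f ⊛ g) ⊛ h) n
    ≡⟨ cong (_+_ (f 0 * g 0 * h (suc n))) (trans (⊛-distribʳ h (f 0 ·ₛ tail g) (tail f ⊛ g) n)
         (cong₂ _+_ (·ₛ-⊛ (f 0) (tail g) h n) (⊛-assoc (tail f) g h n))) ⟩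
  f 0 * g 0 * h (suc n) + (f 0 * (tail g ⊛ h) n + (tail f ⊛ (g ⊛ h)) n)
    ≡⟨ regroup (f 0) (g 0) (h (suc n)) _ _ ⟩
  f 0 * (g 0 * h (suc n) + (tail g ⊛ h) n) + (tail f ⊛ (g ⊛ h)) n
    ≡⟨ cong (λ z → f 0 * z + (tail f ⊛ (g ⊛ h)) n) (⊛-at-suc g h n) ⟨
  f 0 * (g ⊛ h) (suc n) + (tail f ⊛ (g ⊛ h)) n
    ≡⟨ ⊛-at-suc f (g ⊛ h) n ⟨
  (f ⊛ (g ⊛ h)) (suc n) ∎
  where
  open ≡-Reasoning
  regroup : ∀ a b c d e → a * b * c + (a * d + e) ≡ a * (b * c + d) + e
  regroup = solve-∀

⊕-isAbelianGroup : IsAbelianGroup _≈ₛ_ _⊕_ 0ₛ -ₛ_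
⊕-isAbelianGroup = Pointwise.isAbelianGroup ℕ ℤP.+-0-isAbelianGroup

≈ₛ-setoid : Setoid 0ℓ 0ℓ
≈ₛ-setoid = IsAbelianGroup.setoid ⊕-isAbelianGroup

⊛-isCommutativeRing : IsCommutativeRing _≈ₛ_ _⊕_ _⊛_ -ₛ_ 0ₛ 1ₛ
⊛-isCommutativeRing = record
  { isRing = record
    { +-isAbelianGroup = ⊕-isAbelianGroup
    ; *-cong           = ⊛-cong
    ; *-assoc          = ⊛-assoc
    ; *-identity       = comm∧idˡ⇒id ⊛-comm ⊛-identityˡ
    ; distrib          = comm∧distrʳ⇒distr ⊕-cong ⊛-comm ⊛-distribʳ
    }
  ; *-comm = ⊛-comm
  }
  where open Consequences ≈ₛ-setoid

seriesRing : CommutativeRing 0ℓ 0ℓ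
seriesRing = record { isCommutativeRing = ⊛-isCommutativeRing }

ℤ-rawRing : RawRing 0ℓ 0ℓ
ℤ-rawRing = CommutativeRing.rawRing ℤP.+-*-commutativeRing

const-homomorphism : ℤ-rawRing -Raw-AlmostCommutative⟶ fromCommutativeRing seriesRing
const-homomorphism = record
  { ⟦_⟧    = const
  ; +-homo = λ { a b zero → refl ; a b (suc n) → refl }
  ; *-homo = λ a b n → sym (trans (const-⊛ a (const b) n) (·ₛ-const a b n))
  ; -‿homo = λ { a zero → refl ; a (suc n) → refl }
  ; 0-homo = λ { zero → refl ; (suc n) → refl }
  ; 1-homo = ≈ₛ-refl
  }
  where
  ·ₛ-const : ∀ a b → a ·ₛ const b ≈ₛ const (a * b)
  ·ₛ-const a b zero    = refl
  ·ₛ-const a b (suc n) = ℤP.*-zeroʳ a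

const-≟ : ∀ a b → Maybe (const a ≈ₛ const b)
const-≟ a b with a ℤ.≟ b
... | yes refl = just ≈ₛ-refl
... | no _     = nothing

open Algebra.Solver.Ring ℤ-rawRing (fromCommutativeRing seriesRing) const-homomorphism const-≟
  using (solve; _:=_; _:+_; _:*_; :-_; _:-_; con)

X*-as-x⊛ : ∀ f → X* f ≈ₛ x ⊛ f
X*-as-x⊛ f zero    = sym (⊛-at-0 x f)
X*-as-x⊛ f (suc n) = sym (trans (⊛-at-suc x f n) (trans (ℤP.+-identityˡ _) (⊛-identityˡ f n)))

X*X*-as-x⊛x⊛ : ∀ f → X* (X* f) ≈ₛ x ⊛ (x ⊛ f)
X*X*-as-x⊛x⊛ f n = trans (X*-as-x⊛ (X* f) n) (⊛-cong {x} ≈ₛ-refl (X*-as-x⊛ f) n)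

·ₛX*-as-const⊛x⊛ : ∀ c f → c ·ₛ X* f ≈ₛ const c ⊛ (x ⊛ f)
·ₛX*-as-const⊛x⊛ c f n = trans (sym (const-⊛ c (X* f) n)) (⊛-cong {const c} ≈ₛ-refl (X*-as-x⊛ f) n)

u⊛f≈0⇒f≈0 : ∀ {u f} → u 0 ≢ + 0 → u ⊛ f ≈ₛ 0ₛ → f ≈ₛ 0ₛ
u⊛f≈0⇒f≈0 {u} {f} u₀≢0 uf≈0 = <-rec (λ n → f n ≡ + 0) step
  where
  step : ∀ n → (∀ {i} → i ℕ.< n → f i ≡ + 0) → f n ≡ + 0
  step n ih with ℤP.i*j≡0⇒i≡0∨j≡0 (u 0) u₀fₙ≡0
    where
    open ≡-Reasoning
    u₀fₙ≡0 : u 0 * f n ≡ + 0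
    u₀fₙ≡0 = begin
      u 0 * f n                                       ≡⟨ ℤP.+-identityˡ _ ⟨
      + 0 + u 0 * f n                                 ≡⟨ cong₂ _+_ (∑<-zero n (λ {i} i<n → cong (_* u (n ∸ i)) (ih i<n)))
                                                                   (trans (cong (λ m → f n * u m) (ℕP.n∸n≡0 n))
                                                                          (ℤP.*-comm (f n) (u 0))) ⟨
      ∑< n (λ i → f i * u (n ∸ i)) + f n * u (n ∸ n)  ≡⟨ ∑<-last n (λ i → f i * u (n ∸ i)) ⟨
      ∑< (suc n) (λ i → f i * u (n ∸ i))              ≡⟨ ⊛-∑< f u n ⟨
      (f ⊛ u) n                                       ≡⟨ ⊛-comm f u n ⟩
      (u ⊛ f) n                                       ≡⟨ uf≈0 n ⟩
      + 0                                             ∎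
  ... | inj₁ u₀≡0 = contradiction u₀≡0 u₀≢0
  ... | inj₂ fₙ≡0 = fₙ≡0

⊛-cancelˡ : ∀ {u f g} → u 0 ≢ + 0 → u ⊛ f ≈ₛ u ⊛ g → f ≈ₛ g
⊛-cancelˡ {u} {f} {g} u₀≢0 uf≈ug n =
  ℤP.i-j≡0⇒i≡j (f n) (g n) (u⊛f≈0⇒f≈0 {u} {f ⊕ -ₛ g} u₀≢0 u[f-g]≈0 n)
  where
  u[f-g]≈0 : u ⊛ (f ⊕ -ₛ g) ≈ₛ 0ₛ
  u[f-g]≈0 m = trans (solve 3 (λ u f g → u :* (f :- g) := u :* f :- u :* g) ≈ₛ-refl u f g m)
                     (trans (cong (λ z → z + - (u ⊛ g) m) (uf≈ug m)) (ℤP.+-inverseʳ ((u ⊛ g) m)))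

-- Each step of the closed-form derivation is a ring identity modulo earlier equations l ≈ r;
-- the multipliers c form the certificate.
≈-modulo : ∀ {a b l r} c → l ≈ₛ r → a ≈ₛ b ⊕ c ⊛ (l ⊕ -ₛ r) → a ≈ₛ b
≈-modulo {a} {b} {l} {r} c l≈r a≈ n = begin
  a n                       ≡⟨ a≈ n ⟩
  b n + (c ⊛ (l ⊕ -ₛ r)) n  ≡⟨ cong (_+_ (b n)) (trans (⊛-comm c (l ⊕ -ₛ r) n)
                                 (trans (⊛-cong {g = c} l-r≈0 ≈ₛ-refl n) (⊛-zeroˡ c n))) ⟩
  b n + + 0                 ≡⟨ ℤP.+-identityʳ (b n) ⟩
  b n                       ∎
  where
  open ≡-Reasoning
  l-r≈0 : l ⊕ -ₛ r ≈ₛ 0ₛ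
  l-r≈0 m = trans (cong (_+ - r m) (l≈r m)) (ℤP.+-inverseʳ (r m))

a²≈b²⇒a≈-b : ∀ {a b} → a ⊛ a ≈ₛ b ⊛ b → a 0 ≢ b 0 → a ≈ₛ -ₛ b
a²≈b²⇒a≈-b {a} {b} a²≈b² a₀≢b₀ = ⊛-cancelˡ {a ⊕ -ₛ b} (a₀≢b₀ ∘′ ℤP.i-j≡0⇒i≡j (a 0) (b 0))
  (≈-modulo 1ₛ a²≈b² (solve 2 (λ a b → (a :- b) :* a := (a :- b) :* (:- b) :+ con (+ 1) :* (a :* a :- b :* b))
                        ≈ₛ-refl a b))

θ : Series → Series
θ f n = + n * f n

θ-cong : ∀ {f g} → f ≈ₛ g → θ f ≈ₛ θ g
θ-cong f≈g n = cong (+ n *_) (f≈g n)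

θ-⊕ : ∀ {f g f′ g′} → θ f ≈ₛ f′ → θ g ≈ₛ g′ → θ (f ⊕ g) ≈ₛ f′ ⊕ g′
θ-⊕ {f} {g} θf≈ θg≈ n = trans (ℤP.*-distribˡ-+ (+ n) (f n) (g n)) (cong₂ _+_ (θf≈ n) (θg≈ n))

θ--ₛ : ∀ {f f′} → θ f ≈ₛ f′ → θ (-ₛ f) ≈ₛ -ₛ f′
θ--ₛ {f} θf≈ n = trans (sym (ℤP.neg-distribʳ-* (+ n) (f n))) (cong -_ (θf≈ n))

θ-const : ∀ c → θ (const c) ≈ₛ const (+ 0)
θ-const c zero    = refl
θ-const c (suc n) = ℤP.*-zeroʳ (+ suc n)

θ-x : θ x ≈ₛ x
θ-x zero          = refl
θ-x (suc zero)    = refl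
θ-x (suc (suc n)) = ℤP.*-zeroʳ (+ suc (suc n))

θ-Leibniz : ∀ f g → θ (f ⊛ g) ≈ₛ θ f ⊛ g ⊕ f ⊛ θ g
θ-Leibniz f g n = begin
  + n * (f ⊛ g) n
    ≡⟨ cong (+ n *_) (⊛-∑< f g n) ⟩
  + n * ∑< (suc n) (λ i → f i * g (n ∸ i))
    ≡⟨ ∑<-*ˡ (suc n) (+ n) (λ i → f i * g (n ∸ i)) ⟨
  ∑< (suc n) (λ i → + n * (f i * g (n ∸ i)))
    ≡⟨ ∑<-cong (suc n) (λ {i} i≤n → n=i+[n-i] i (ℕP.≤-pred i≤n)) ⟩
  ∑< (suc n) (λ i → θ f i * g (n ∸ i) + f i * θ g (n ∸ i))
    ≡⟨ ∑<-+ (suc n) (λ i → θ f i * g (n ∸ i)) (λ i → f i * θ g (n ∸ i)) ⟩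
  ∑< (suc n) (λ i → θ f i * g (n ∸ i)) + ∑< (suc n) (λ i → f i * θ g (n ∸ i))
    ≡⟨ cong₂ _+_ (⊛-∑< (θ f) g n) (⊛-∑< f (θ g) n) ⟨
  (θ f ⊛ g ⊕ f ⊛ θ g) n ∎
  where
  open ≡-Reasoning
  distribute : ∀ i j a b → (i + j) * (a * b) ≡ i * a * b + a * (j * b)
  distribute = solve-∀
  n=i+[n-i] : ∀ i → i ℕ.≤ n → + n * (f i * g (n ∸ i)) ≡ θ f i * g (n ∸ i) + f i * θ g (n ∸ i)
  n=i+[n-i] i i≤n = trans (cong (λ m → + m * (f i * g (n ∸ i))) (sym (ℕP.m+[n∸m]≡n i≤n)))
                          (distribute (+ i) (+ (n ∸ i)) (f i) (g (n ∸ i)))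

θ-⊛ : ∀ {f g f′ g′} → θ f ≈ₛ f′ → θ g ≈ₛ g′ → θ (f ⊛ g) ≈ₛ f′ ⊛ g ⊕ f ⊛ g′
θ-⊛ {f} {g} θf≈ θg≈ n =
  trans (θ-Leibniz f g n) (cong₂ _+_ (⊛-cong {g = g} θf≈ ≈ₛ-refl n) (⊛-cong {f} ≈ₛ-refl θg≈ n))

θ-both : ∀ {l r l′ r′} → l ≈ₛ r → θ l ≈ₛ l′ → θ r ≈ₛ r′ → l′ ≈ₛ r′
θ-both l≈r θl≈ θr≈ n = trans (sym (θl≈ n)) (trans (θ-cong l≈r n) (θr≈ n))

∂X*-as-θ⊕ : ∀ f → ∂ (X* f) ≈ₛ θ f ⊕ f
∂X*-as-θ⊕ f n = trans (ℤP.*-distribʳ-+ (f n) (+ 1) (+ n))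
                      (trans (ℤP.+-comm (+ 1 * f n) _) (cong (_+_ (+ n * f n)) (ℤP.*-identityˡ (f n))))

-- Sums over lists and generating functions of weighted words

∑ : {A : Set} → List A → (A → ℤ) → ℤ
∑ xs F = sumℤ (map F xs)

module _ {A : Set} where

  ∑-cong : ∀ (xs : List A) {F G} → (∀ a → F a ≡ G a) → ∑ xs F ≡ ∑ xs G
  ∑-cong []       eq = refl
  ∑-cong (a ∷ xs) eq = cong₂ _+_ (eq a) (∑-cong xs eq)

  ∑-zero : ∀ (xs : List A) → ∑ xs (λ _ → + 0) ≡ + 0
  ∑-zero []       = refl
  ∑-zero (a ∷ xs) = trans (ℤP.+-identityˡ _) (∑-zero xs)

  ∑-+ : ∀ (xs : List A) F G → ∑ xs (λ a → F a + G a) ≡ ∑ xs F + ∑ xs G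
  ∑-+ []       F G = refl
  ∑-+ (a ∷ xs) F G = trans (cong (_+_ (F a + G a)) (∑-+ xs F G)) (interchange (F a) (G a) _ _)

  ∑-*ˡ : ∀ (xs : List A) c F → ∑ xs (λ a → c * F a) ≡ c * ∑ xs F
  ∑-*ˡ []       c F = sym (ℤP.*-zeroʳ c)
  ∑-*ˡ (a ∷ xs) c F = trans (cong (_+_ (c * F a)) (∑-*ˡ xs c F)) (sym (ℤP.*-distribˡ-+ c (F a) _))

  ∑-++ : ∀ (xs ys : List A) F → ∑ (xs ++ ys) F ≡ ∑ xs F + ∑ ys F
  ∑-++ []       ys F = sym (ℤP.+-identityˡ _)
  ∑-++ (a ∷ xs) ys F = trans (cong (_+_ (F a)) (∑-++ xs ys F)) (sym (ℤP.+-assoc (F a) _ _))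

  ∑-filter : ∀ {P : Pred A 0ℓ} (P? : Decidable P) xs {F G} →
             (∀ a → P a → F a ≡ G a) → (∀ a → ¬ P a → G a ≡ + 0) → ∑ (filter P? xs) F ≡ ∑ xs G
  ∑-filter P? []       onP offP = refl
  ∑-filter P? (a ∷ xs) {F} {G} onP offP with P? a
  ... | yes p = cong₂ _+_ (onP a p) (∑-filter P? xs onP offP)
  ... | no ¬p = trans (∑-filter P? xs onP offP)
                      (sym (trans (cong (_+ ∑ xs G) (offP a ¬p)) (ℤP.+-identityˡ (∑ xs G))))

  length-as-∑ : ∀ (xs : List A) → + length xs ≡ ∑ xs (λ _ → + 1)
  length-as-∑ []       = refl
  length-as-∑ (a ∷ xs) = cong (_+_ (+ 1)) (length-as-∑ xs)

module _ {A B : Set} where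

  ∑-comm : ∀ (xs : List A) (ys : List B) (F : A → B → ℤ) →
           ∑ xs (λ a → ∑ ys (F a)) ≡ ∑ ys (λ b → ∑ xs (λ a → F a b))
  ∑-comm []       ys F = sym (∑-zero ys)
  ∑-comm (a ∷ xs) ys F = trans (cong (_+_ (∑ ys (F a))) (∑-comm xs ys F))
                               (sym (∑-+ ys (F a) (λ b → ∑ xs (λ a′ → F a′ b))))

  ∑-concatMap : ∀ (f : A → List B) xs (F : B → ℤ) → ∑ (concatMap f xs) F ≡ ∑ xs (λ a → ∑ (f a) F)
  ∑-concatMap f []       F = refl
  ∑-concatMap f (a ∷ xs) F =
    trans (∑-++ (f a) (concatMap f xs) F) (cong (_+_ (∑ (f a) F)) (∑-concatMap f xs F))

  ∑-product : ∀ (xs : List A) (ys : List B) (f : A → ℤ) (g : B → ℤ) →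
              ∑ xs (λ a → ∑ ys (λ b → f a * g b)) ≡ ∑ xs f * ∑ ys g
  ∑-product xs ys f g = begin
    ∑ xs (λ a → ∑ ys (λ b → f a * g b))  ≡⟨ ∑-cong xs (λ a → ∑-*ˡ ys (f a) g) ⟩
    ∑ xs (λ a → f a * ∑ ys g)            ≡⟨ ∑-cong xs (λ a → ℤP.*-comm (f a) _) ⟩
    ∑ xs (λ a → ∑ ys g * f a)            ≡⟨ ∑-*ˡ xs (∑ ys g) f ⟩
    ∑ ys g * ∑ xs f                      ≡⟨ ℤP.*-comm (∑ ys g) _ ⟩
    ∑ xs f * ∑ ys g                      ∎
    where open ≡-Reasoning

steps : List Step
steps = U ∷ D ∷ O₁ ∷ O₂ ∷ []

∑prepend : (List Step → ℤ) → List Step → ℤ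
∑prepend F w = ∑ steps (λ s → F (s ∷ w))

gf : (List Step → ℤ) → Series
gf F n = ∑ (words n) F

∑-words-suc : ∀ n (F : List Step → ℤ) → ∑ (words (suc n)) F ≡ ∑ (words n) (∑prepend F)
∑-words-suc n F = ∑-concatMap (λ w → map (_∷ w) steps) (words n) F

∑-words-cong : ∀ n {F G} → (∀ w → length w ≡ n → F w ≡ G w) → ∑ (words n) F ≡ ∑ (words n) G
∑-words-cong zero    eq = cong (_+ + 0) (eq [] refl)
∑-words-cong (suc n) {F} {G} eq = begin
  ∑ (words (suc n)) F        ≡⟨ ∑-words-suc n F ⟩
  ∑ (words n) (∑prepend F)   ≡⟨ ∑-words-cong n (λ w |w|≡n → ∑-cong steps (λ s → eq (s ∷ w) (cong suc |w|≡n))) ⟩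
  ∑ (words n) (∑prepend G)   ≡⟨ ∑-words-suc n G ⟨
  ∑ (words (suc n)) G        ∎
  where open ≡-Reasoning

gf-cong : ∀ {F G} → (∀ w → F w ≡ G w) → gf F ≈ₛ gf G
gf-cong eq n = ∑-cong (words n) eq

gf-⊕ : ∀ (F G : List Step → ℤ) → gf (λ w → F w + G w) ≈ₛ gf F ⊕ gf G
gf-⊕ F G n = ∑-+ (words n) F G

gf-∑prepend : ∀ (F : List Step → ℤ) → gf F ≈ₛ const (F []) ⊕ x ⊛ gf (∑prepend F)
gf-∑prepend F zero    = refl
gf-∑prepend F (suc n) = begin
  gf F (suc n)                         ≡⟨ ∑-words-suc n F ⟩
  gf (∑prepend F) n                    ≡⟨ X*-as-x⊛ (gf (∑prepend F)) (suc n) ⟩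
  (x ⊛ gf (∑prepend F)) (suc n)        ≡⟨ ℤP.+-identityˡ _ ⟨
  + 0 + (x ⊛ gf (∑prepend F)) (suc n)  ∎
  where open ≡-Reasoning

gf-length : ∀ (F : List Step → ℤ) → gf (λ w → + suc (length w) * F w) ≈ₛ ∂ (X* (gf F))
gf-length F n = trans (∑-words-cong n (λ w |w|≡n → cong (λ m → + suc m * F w) |w|≡n))
                      (∑-*ˡ (words n) (+ suc n) F)

-- ∑D-splits K w is the sum of K q p over all factorisations w = q ++ D ∷ p.
∑D-splits : (List Step → List Step → ℤ) → List Step → ℤ
∑D-splits K []       = + 0
∑D-splits K (U ∷ w)  = ∑D-splits (λ q → K (U ∷ q)) w
∑D-splits K (D ∷ w)  = K [] w + ∑D-splits (λ q → K (D ∷ q)) w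
∑D-splits K (O₁ ∷ w) = ∑D-splits (λ q → K (O₁ ∷ q)) w
∑D-splits K (O₂ ∷ w) = ∑D-splits (λ q → K (O₂ ∷ q)) w

∑D-splits-cong : ∀ w {K L} → (∀ q p → K q p ≡ L q p) → ∑D-splits K w ≡ ∑D-splits L w
∑D-splits-cong []       eq = refl
∑D-splits-cong (U ∷ w)  eq = ∑D-splits-cong w (eq ∘ (U ∷_))
∑D-splits-cong (D ∷ w)  eq = cong₂ _+_ (eq [] w) (∑D-splits-cong w (eq ∘ (D ∷_)))
∑D-splits-cong (O₁ ∷ w) eq = ∑D-splits-cong w (eq ∘ (O₁ ∷_))
∑D-splits-cong (O₂ ∷ w) eq = ∑D-splits-cong w (eq ∘ (O₂ ∷_))

∑D-splits-zero : ∀ w {K} → (∀ q p → K q p ≡ + 0) → ∑D-splits K w ≡ + 0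
∑D-splits-zero []       eq = refl
∑D-splits-zero (U ∷ w)  eq = ∑D-splits-zero w (eq ∘ (U ∷_))
∑D-splits-zero (D ∷ w)  eq = cong₂ _+_ (eq [] w) (∑D-splits-zero w (eq ∘ (D ∷_)))
∑D-splits-zero (O₁ ∷ w) eq = ∑D-splits-zero w (eq ∘ (O₁ ∷_))
∑D-splits-zero (O₂ ∷ w) eq = ∑D-splits-zero w (eq ∘ (O₂ ∷_))

∑D-splits-+ : ∀ w (K L : List Step → List Step → ℤ) →
              ∑D-splits (λ q p → K q p + L q p) w ≡ ∑D-splits K w + ∑D-splits L w
∑D-splits-+ []       K L = refl
∑D-splits-+ (U ∷ w)  K L = ∑D-splits-+ w (K ∘ (U ∷_)) (L ∘ (U ∷_))
∑D-splits-+ (D ∷ w)  K L = trans (cong (_+_ (K [] w + L [] w)) (∑D-splits-+ w (K ∘ (D ∷_)) (L ∘ (D ∷_))))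
                                 (interchange (K [] w) (L [] w) _ _)
∑D-splits-+ (O₁ ∷ w) K L = ∑D-splits-+ w (K ∘ (O₁ ∷_)) (L ∘ (O₁ ∷_))
∑D-splits-+ (O₂ ∷ w) K L = ∑D-splits-+ w (K ∘ (O₂ ∷_)) (L ∘ (O₂ ∷_))

∑D-splits-*ʳ : ∀ w (K : List Step → List Step → ℤ) (F : List Step → ℤ) →
               ∑D-splits K w * F w ≡ ∑D-splits (λ q p → K q p * F (q ++ D ∷ p)) w
∑D-splits-*ʳ []       K F = refl
∑D-splits-*ʳ (U ∷ w)  K F = ∑D-splits-*ʳ w (K ∘ (U ∷_)) (F ∘ (U ∷_))
∑D-splits-*ʳ (D ∷ w)  K F = trans (ℤP.*-distribʳ-+ (F (D ∷ w)) (K [] w) _)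
                                  (cong (_+_ (K [] w * F (D ∷ w))) (∑D-splits-*ʳ w (K ∘ (D ∷_)) (F ∘ (D ∷_))))
∑D-splits-*ʳ (O₁ ∷ w) K F = ∑D-splits-*ʳ w (K ∘ (O₁ ∷_)) (F ∘ (O₁ ∷_))
∑D-splits-*ʳ (O₂ ∷ w) K F = ∑D-splits-*ʳ w (K ∘ (O₂ ∷_)) (F ∘ (O₂ ∷_))

∑D-splits-∑ : ∀ {A : Set} (xs : List A) w (K : A → List Step → List Step → ℤ) →
              ∑D-splits (λ q p → ∑ xs (λ a → K a q p)) w ≡ ∑ xs (λ a → ∑D-splits (K a) w)
∑D-splits-∑ []       w K = ∑D-splits-zero w (λ _ _ → refl)
∑D-splits-∑ (a ∷ xs) w K = trans (∑D-splits-+ w (K a) (λ q p → ∑ xs (λ a′ → K a′ q p)))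
                                 (cong (_+_ (∑D-splits (K a) w)) (∑D-splits-∑ xs w K))

∑prepend-∑D-splits : ∀ (K : List Step → List Step → ℤ) w →
  ∑prepend (∑D-splits K) w ≡ K [] w + ∑D-splits (λ q p → ∑prepend (λ q′ → K q′ p) q) w
∑prepend-∑D-splits K w =
  trans (regroup (∑D-splits (K ∘ (U ∷_)) w) (K [] w) (∑D-splits (K ∘ (D ∷_)) w) _)
        (cong (_+_ (K [] w)) (sym (∑D-splits-∑ steps w (λ s q → K (s ∷ q)))))
  where
  regroup : ∀ a k b c → a + (k + b + c) ≡ k + (a + (b + c))
  regroup = solve-∀

gf-∑D-splits : ∀ n (K : List Step → List Step → ℤ) →
               gf (∑D-splits K) n ≡ ∑< n (λ i → ∑ (words i) (λ q → ∑ (words (n ∸ suc i)) (K q)))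
gf-∑D-splits zero    K = refl
gf-∑D-splits (suc n) K = begin
  gf (∑D-splits K) (suc n)
    ≡⟨ ∑-words-suc n (∑D-splits K) ⟩
  ∑ (words n) (∑prepend (∑D-splits K))
    ≡⟨ ∑-cong (words n) (∑prepend-∑D-splits K) ⟩
  ∑ (words n) (λ w → K [] w + ∑D-splits K′ w)
    ≡⟨ ∑-+ (words n) (K []) (∑D-splits K′) ⟩
  ∑ (words n) (K []) + gf (∑D-splits K′) n
    ≡⟨ cong₂ _+_ (sym (ℤP.+-identityʳ (∑ (words n) (K [])))) (gf-∑D-splits n K′) ⟩
  ∑ (words 0) (λ q → ∑ (words n) (K q)) + ∑< n (λ i → ∑ (words i) (λ q → ∑ (words (n ∸ suc i)) (K′ q)))
    ≡⟨ cong (_+_ (∑ (words 0) (λ q → ∑ (words n) (K q)))) (∑<-cong n (λ {i} _ → begin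
         ∑ (words i) (λ q → ∑ (words (n ∸ suc i)) (K′ q))
           ≡⟨ ∑-cong (words i) (λ q → ∑-comm steps (words (n ∸ suc i)) (λ s p → K (s ∷ q) p)) ⟨
         ∑ (words i) (∑prepend (λ q → ∑ (words (n ∸ suc i)) (K q)))
           ≡⟨ ∑-words-suc i (λ q → ∑ (words (n ∸ suc i)) (K q)) ⟨
         ∑ (words (suc i)) (λ q → ∑ (words (n ∸ suc i)) (K q)) ∎)) ⟩
  ∑< (suc n) (λ i → ∑ (words i) (λ q → ∑ (words (suc n ∸ suc i)) (K q))) ∎
  where
  open ≡-Reasoning
  K′ : List Step → List Step → ℤ
  K′ q p = ∑prepend (λ q′ → K q′ p) q

gf-∑D-splits-* : ∀ (f g : List Step → ℤ) → gf (∑D-splits (λ q p → f q * g p)) ≈ₛ x ⊛ (gf f ⊛ gf g)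
gf-∑D-splits-* f g zero    = refl
gf-∑D-splits-* f g (suc n) = begin
  gf (∑D-splits (λ q p → f q * g p)) (suc n)
    ≡⟨ gf-∑D-splits (suc n) (λ q p → f q * g p) ⟩
  ∑< (suc n) (λ i → ∑ (words i) (λ q → ∑ (words (n ∸ i)) (λ p → f q * g p)))
    ≡⟨ ∑<-cong (suc n) (λ {i} _ → ∑-product (words i) (words (n ∸ i)) f g) ⟩
  ∑< (suc n) (λ i → gf f i * gf g (n ∸ i))
    ≡⟨ ⊛-∑< (gf f) (gf g) n ⟨
  (gf f ⊛ gf g) n
    ≡⟨ X*-as-x⊛ (gf f ⊛ gf g) (suc n) ⟩
  (x ⊛ (gf f ⊛ gf g)) (suc n) ∎
  where open ≡-Reasoning

-- Weighted lattice paths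

nonnegWeight : (ℕ → ℤ) → ℕ → List Step → ℤ
nonnegWeight k h       []       = k h
nonnegWeight k h       (U ∷ w)  = nonnegWeight k (suc h) w
nonnegWeight k zero    (D ∷ w)  = + 0
nonnegWeight k (suc h) (D ∷ w)  = nonnegWeight k h w
nonnegWeight k h       (O₁ ∷ w) = nonnegWeight k h w
nonnegWeight k h       (O₂ ∷ w) = nonnegWeight k h w

isZero : ℕ → ℤ
isZero zero    = + 1
isZero (suc _) = + 0

nonnegInd motzkinInd : ℕ → List Step → ℤ
nonnegInd  = nonnegWeight (λ _ → + 1)
motzkinInd = nonnegWeight isZero

-- ℕ.pred gives a junk height after a D step at height 0; area is only ever multiplied by a
-- weight that vanishes on such paths.
area : ℕ → List Step → ℤ
area h []       = + h
area h (U ∷ w)  = + h + area (suc h) w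
area h (D ∷ w)  = + h + area (ℕ.pred h) w
area h (O₁ ∷ w) = + h + area h w
area h (O₂ ∷ w) = + h + area h w

nonnegWeight-zero : ∀ h w → nonnegWeight (λ _ → + 0) h w ≡ + 0
nonnegWeight-zero h       []       = refl
nonnegWeight-zero h       (U ∷ w)  = nonnegWeight-zero (suc h) w
nonnegWeight-zero zero    (D ∷ w)  = refl
nonnegWeight-zero (suc h) (D ∷ w)  = nonnegWeight-zero h w
nonnegWeight-zero h       (O₁ ∷ w) = nonnegWeight-zero h w
nonnegWeight-zero h       (O₂ ∷ w) = nonnegWeight-zero h w

-- A path from height h + 1 either stays at height ≥ 1, or reaches 0 for the first time by a
-- D step after a prefix q which, lowered by one, is a Motzkin path from height h.
nonnegWeight-first-passage : ∀ k h w →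
  nonnegWeight k (suc h) w
    ≡ nonnegWeight (k ∘ suc) h w + ∑D-splits (λ q p → motzkinInd h q * nonnegWeight k 0 p) w
nonnegWeight-first-passage k h       []       = sym (ℤP.+-identityʳ (k (suc h)))
nonnegWeight-first-passage k h       (U ∷ w)  = nonnegWeight-first-passage k (suc h) w
nonnegWeight-first-passage k zero    (D ∷ w)  = sym (begin
  + 0 + (+ 1 * nonnegWeight k 0 w + ∑D-splits (λ _ _ → + 0) w)
    ≡⟨ cong (λ z → + 0 + (+ 1 * nonnegWeight k 0 w + z)) (∑D-splits-zero w (λ _ _ → refl)) ⟩
  + 0 + (+ 1 * nonnegWeight k 0 w + + 0)
    ≡⟨ trans (ℤP.+-identityˡ _) (trans (ℤP.+-identityʳ _) (ℤP.*-identityˡ _)) ⟩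
  nonnegWeight k 0 w ∎)
  where open ≡-Reasoning
nonnegWeight-first-passage k (suc h) (D ∷ w)  =
  trans (nonnegWeight-first-passage k h w) (cong (_+_ (nonnegWeight (k ∘ suc) h w)) (sym (ℤP.+-identityˡ _)))
nonnegWeight-first-passage k h       (O₁ ∷ w) = nonnegWeight-first-passage k h w
nonnegWeight-first-passage k h       (O₂ ∷ w) = nonnegWeight-first-passage k h w

weighted-+ˡ : ∀ W {a r} c → W * a ≡ W * r → W * (c + a) ≡ W * (c + r)
weighted-+ˡ W {a} {r} c eq = begin
  W * (c + a)    ≡⟨ ℤP.*-distribˡ-+ W c a ⟩
  W * c + W * a  ≡⟨ cong (_+_ (W * c)) eq ⟩
  W * c + W * r  ≡⟨ ℤP.*-distribˡ-+ W c r ⟨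
  W * (c + r)    ∎
  where open ≡-Reasoning

area-suc-step : ∀ W c {a} b L → W * a ≡ W * (b + L) → W * ((+ 1 + c) + a) ≡ W * ((c + b) + (+ 1 + L))
area-suc-step W c {a} b L eq = trans (weighted-+ˡ W (+ 1 + c) eq) (cong (W *_) (regroup c b L))
  where
  regroup : ∀ c b L → (+ 1 + c) + (b + L) ≡ (c + b) + (+ 1 + L)
  regroup = solve-∀

area-++-step : ∀ M c {a} b d → M * a ≡ M * (b + d) → M * (c + a) ≡ M * ((c + b) + d)
area-++-step M c {a} b d eq = trans (weighted-+ˡ M c eq) (cong (M *_) (sym (ℤP.+-assoc c b d)))

-- The weight factors make the next two identities unconditional: they vanish on paths that
-- go below the axis.
area-suc : ∀ k h w → nonnegWeight k h w * area (suc h) w ≡ nonnegWeight k h w * (area h w + + suc (length w))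
area-suc k h       []       = cong (λ m → k h * + m) (ℕP.+-comm 1 h)
area-suc k h       (U ∷ w) =
  area-suc-step (nonnegWeight k (suc h) w) (+ h) (area (suc h) w) (+ suc (length w)) (area-suc k (suc h) w)
area-suc k zero    (D ∷ w)  = refl
area-suc k (suc h) (D ∷ w) =
  area-suc-step (nonnegWeight k h w) (+ suc h) (area h w) (+ suc (length w)) (area-suc k h w)
area-suc k h       (O₁ ∷ w) =
  area-suc-step (nonnegWeight k h w) (+ h) (area h w) (+ suc (length w)) (area-suc k h w)
area-suc k h       (O₂ ∷ w) =
  area-suc-step (nonnegWeight k h w) (+ h) (area h w) (+ suc (length w)) (area-suc k h w)

area-++ : ∀ h q p → motzkinInd h q * area (suc h) (q ++ D ∷ p) ≡ motzkinInd h q * (area (suc h) q + area 0 p)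
area-++ zero    []       p = refl
area-++ (suc h) []       p = refl
area-++ h       (U ∷ q)  p =
  area-++-step (motzkinInd (suc h) q) (+ suc h) (area (suc (suc h)) q) (area 0 p) (area-++ (suc h) q p)
area-++ zero    (D ∷ q)  p = refl
area-++ (suc h) (D ∷ q)  p =
  area-++-step (motzkinInd h q) (+ suc (suc h)) (area (suc h) q) (area 0 p) (area-++ h q p)
area-++ h       (O₁ ∷ q) p =
  area-++-step (motzkinInd h q) (+ suc h) (area (suc h) q) (area 0 p) (area-++ h q p)
area-++ h       (O₂ ∷ q) p =
  area-++-step (motzkinInd h q) (+ suc h) (area (suc h) q) (area 0 p) (area-++ h q p)

-- The four generating functions as generating functions of weights

NonnegFrom : ℤ → List Step → Set
NonnegFrom z w = All (+ 0 ≤_) (heightsFrom z w)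

NonnegFrom-head : ∀ {z} w → NonnegFrom z w → + 0 ≤ z
NonnegFrom-head []      (0≤z ∷ _) = 0≤z
NonnegFrom-head (_ ∷ _) (0≤z ∷ _) = 0≤z

height-U : ∀ h → + h + δ U ≡ + suc h
height-U h = cong +_ (ℕP.+-comm h 1)

height-O : ∀ h → + h + + 0 ≡ + h
height-O h = ℤP.+-identityʳ (+ h)

endHeight-∷ : ∀ h s w {h′} → + h + δ s ≡ h′ → h′ + endHeight w ≡ + h + endHeight (s ∷ w)
endHeight-∷ h s w eq = trans (cong (_+ endHeight w) (sym eq)) (ℤP.+-assoc (+ h) (δ s) (endHeight w))

nonnegWeight-nonneg : ∀ k h w → NonnegFrom (+ h) w → nonnegWeight k h w ≡ k ∣ + h + endHeight w ∣
nonnegWeight-nonneg k h       []       _        = cong k (sym (ℕP.+-identityʳ h))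
nonnegWeight-nonneg k h       (U ∷ w)  (_ ∷ nn) =
  trans (nonnegWeight-nonneg k (suc h) w (subst (λ z → NonnegFrom z w) (height-U h) nn))
        (cong (k ∘ ∣_∣) (endHeight-∷ h U w (height-U h)))
nonnegWeight-nonneg k zero    (D ∷ w)  (_ ∷ nn) with () ← NonnegFrom-head w nn
nonnegWeight-nonneg k (suc h) (D ∷ w)  (_ ∷ nn) =
  trans (nonnegWeight-nonneg k h w nn) (cong (k ∘ ∣_∣) (endHeight-∷ (suc h) D w refl))
nonnegWeight-nonneg k h       (O₁ ∷ w) (_ ∷ nn) =
  trans (nonnegWeight-nonneg k h w (subst (λ z → NonnegFrom z w) (height-O h) nn))
        (cong (k ∘ ∣_∣) (endHeight-∷ h O₁ w (height-O h)))
nonnegWeight-nonneg k h       (O₂ ∷ w) (_ ∷ nn) =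
  trans (nonnegWeight-nonneg k h w (subst (λ z → NonnegFrom z w) (height-O h) nn))
        (cong (k ∘ ∣_∣) (endHeight-∷ h O₂ w (height-O h)))

nonnegWeight-¬nonneg : ∀ k h w → ¬ NonnegFrom (+ h) w → nonnegWeight k h w ≡ + 0
nonnegWeight-¬nonneg k h       []       ¬nn = contradiction (+≤+ z≤n ∷ []) ¬nn
nonnegWeight-¬nonneg k h       (U ∷ w)  ¬nn = nonnegWeight-¬nonneg k (suc h) w
  (λ nn → ¬nn (+≤+ z≤n ∷ subst (λ z → NonnegFrom z w) (sym (height-U h)) nn))
nonnegWeight-¬nonneg k zero    (D ∷ w)  ¬nn = refl
nonnegWeight-¬nonneg k (suc h) (D ∷ w)  ¬nn = nonnegWeight-¬nonneg k h w (λ nn → ¬nn (+≤+ z≤n ∷ nn))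
nonnegWeight-¬nonneg k h       (O₁ ∷ w) ¬nn = nonnegWeight-¬nonneg k h w
  (λ nn → ¬nn (+≤+ z≤n ∷ subst (λ z → NonnegFrom z w) (sym (height-O h)) nn))
nonnegWeight-¬nonneg k h       (O₂ ∷ w) ¬nn = nonnegWeight-¬nonneg k h w
  (λ nn → ¬nn (+≤+ z≤n ∷ subst (λ z → NonnegFrom z w) (sym (height-O h)) nn))

heightSum : ℤ → List Step → ℤ
heightSum z w = sumℤ (map (λ h → + ∣ h ∣) (heightsFrom z w))

heightSum-area : ∀ h w → NonnegFrom (+ h) w → heightSum (+ h) w ≡ area h w
heightSum-area h       []       _        = ℤP.+-identityʳ (+ h)
heightSum-area h       (U ∷ w)  (_ ∷ nn) = cong (_+_ (+ h)) (trans (cong (λ z → heightSum z w) (height-U h))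
  (heightSum-area (suc h) w (subst (λ z → NonnegFrom z w) (height-U h) nn)))
heightSum-area zero    (D ∷ w)  (_ ∷ nn) with () ← NonnegFrom-head w nn
heightSum-area (suc h) (D ∷ w)  (_ ∷ nn) = cong (_+_ (+ suc h)) (heightSum-area h w nn)
heightSum-area h       (O₁ ∷ w) (_ ∷ nn) = cong (_+_ (+ h)) (trans (cong (λ z → heightSum z w) (height-O h))
  (heightSum-area h w (subst (λ z → NonnegFrom z w) (height-O h) nn)))
heightSum-area h       (O₂ ∷ w) (_ ∷ nn) = cong (_+_ (+ h)) (trans (cong (λ z → heightSum z w) (height-O h))
  (heightSum-area h w (subst (λ z → NonnegFrom z w) (height-O h) nn)))

𝟙𝒩 𝟙ℳ : List Step → ℤ
𝟙𝒩 = nonnegInd 0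
𝟙ℳ = motzkinInd 0

isZero-∣∣ : ∀ {e} → e ≢ + 0 → isZero ∣ e ∣ ≡ + 0
isZero-∣∣ {+ zero}     e≢0 = contradiction refl e≢0
isZero-∣∣ {+ suc _}    _   = refl
isZero-∣∣ { -[1+ _ ] } _   = refl

𝟙ℳ-Motzkin : ∀ w → Motzkin w → 𝟙ℳ w ≡ + 1
𝟙ℳ-Motzkin w (nn , end≡0) =
  trans (nonnegWeight-nonneg isZero 0 w nn) (cong (isZero ∘ ∣_∣) (trans (ℤP.+-identityˡ _) end≡0))

𝟙ℳ-¬Motzkin : ∀ w → ¬ Motzkin w → 𝟙ℳ w ≡ + 0
𝟙ℳ-¬Motzkin w ¬m with nonneg? w
... | no ¬nn = nonnegWeight-¬nonneg isZero 0 w ¬nn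
... | yes nn = trans (nonnegWeight-nonneg isZero 0 w nn)
                     (trans (cong (isZero ∘ ∣_∣) (ℤP.+-identityˡ (endHeight w)))
                            (isZero-∣∣ (λ end≡0 → ¬m (nn , end≡0))))

IsGF : Series → (List Step → ℤ) → Set
IsGF A F = A ≈ₛ gf F

𝒩gf-IsGF : IsGF 𝒩gf 𝟙𝒩
𝒩gf-IsGF n = trans (length-as-∑ (𝒩 n))
  (∑-filter nonneg? (words n) (λ w nn → sym (nonnegWeight-nonneg _ 0 w nn)) (nonnegWeight-¬nonneg _ 0))

ℳgf-IsGF : IsGF ℳgf 𝟙ℳ
ℳgf-IsGF n = trans (length-as-∑ (ℳ n))
  (∑-filter motzkin? (words n) (λ w m → sym (𝟙ℳ-Motzkin w m)) 𝟙ℳ-¬Motzkin)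

𝐍gf-IsGF : IsGF 𝐍gf (λ w → 𝟙𝒩 w * area 0 w)
𝐍gf-IsGF n = ∑-filter nonneg? (words n)
  (λ w nn → trans (heightSum-area 0 w nn)
                  (sym (trans (cong (_* area 0 w) (nonnegWeight-nonneg _ 0 w nn)) (ℤP.*-identityˡ _))))
  (λ w ¬nn → cong (_* area 0 w) (nonnegWeight-¬nonneg _ 0 w ¬nn))

𝐌gf-IsGF : IsGF 𝐌gf (λ w → 𝟙ℳ w * area 0 w)
𝐌gf-IsGF n = ∑-filter motzkin? (words n)
  (λ w m → trans (heightSum-area 0 w (proj₁ m))
                 (sym (trans (cong (_* area 0 w) (𝟙ℳ-Motzkin w m)) (ℤP.*-identityˡ _))))
  (λ w ¬m → cong (_* area 0 w) (𝟙ℳ-¬Motzkin w ¬m))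

IsGF-unique : ∀ {A B F} → IsGF A F → IsGF B F → A ≈ₛ B
IsGF-unique A≈ B≈ n = trans (A≈ n) (sym (B≈ n))

IsGF-weight : ∀ {A F G} → (∀ w → F w ≡ G w) → IsGF A F → IsGF A G
IsGF-weight F≗G A≈ n = trans (A≈ n) (gf-cong F≗G n)

IsGF-⊕ : ∀ {A B F G} → IsGF A F → IsGF B G → IsGF (A ⊕ B) (λ w → F w + G w)
IsGF-⊕ {F = F} {G} A≈ B≈ n = trans (⊕-cong A≈ B≈ n) (sym (gf-⊕ F G n))

IsGF-∑prepend : ∀ {A} F → IsGF A (∑prepend F) → IsGF (const (F []) ⊕ x ⊛ A) F
IsGF-∑prepend F A≈ n =
  trans (cong (_+_ (const (F []) n)) (⊛-cong {x} ≈ₛ-refl A≈ n)) (sym (gf-∑prepend F n))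

IsGF-∑D-splits : ∀ {A B f g} → IsGF A f → IsGF B g → IsGF (x ⊛ (A ⊛ B)) (∑D-splits (λ q p → f q * g p))
IsGF-∑D-splits {f = f} {g} A≈ B≈ n =
  trans (⊛-cong {x} ≈ₛ-refl (⊛-cong A≈ B≈) n) (sym (gf-∑D-splits-* f g n))

IsGF-length : ∀ {A F} → IsGF A F → IsGF (∂ (X* A)) (λ w → + suc (length w) * F w)
IsGF-length {F = F} A≈ n = trans (cong (+ suc n *_) (A≈ n)) (sym (gf-length F n))

motzkinInd-1 : ∀ w → motzkinInd 1 w ≡ ∑D-splits (λ q p → 𝟙ℳ q * 𝟙ℳ p) w
motzkinInd-1 w = trans (nonnegWeight-first-passage isZero 0 w)
  (trans (cong (_+ ∑D-splits (λ q p → 𝟙ℳ q * 𝟙ℳ p) w) (nonnegWeight-zero 0 w)) (ℤP.+-identityˡ _))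

first-step-𝟙ℳ : ∀ w → ∑prepend 𝟙ℳ w ≡ ∑D-splits (λ q p → 𝟙ℳ q * 𝟙ℳ p) w + (𝟙ℳ w + 𝟙ℳ w)
first-step-𝟙ℳ w = trans (cong (_+ (+ 0 + (𝟙ℳ w + (𝟙ℳ w + + 0)))) (motzkinInd-1 w))
                        (regroup (∑D-splits (λ q p → 𝟙ℳ q * 𝟙ℳ p) w) (𝟙ℳ w))
  where
  regroup : ∀ s m → s + (+ 0 + (m + (m + + 0))) ≡ s + (m + m)
  regroup = solve-∀

first-step-𝟙𝒩 : ∀ w → ∑prepend 𝟙𝒩 w ≡ ∑D-splits (λ q p → 𝟙ℳ q * 𝟙𝒩 p) w + (𝟙𝒩 w + (𝟙𝒩 w + 𝟙𝒩 w))
first-step-𝟙𝒩 w =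
  trans (cong (_+ (+ 0 + (𝟙𝒩 w + (𝟙𝒩 w + + 0)))) (nonnegWeight-first-passage (λ _ → + 1) 0 w))
        (regroup (∑D-splits (λ q p → 𝟙ℳ q * 𝟙𝒩 p) w) (𝟙𝒩 w))
  where
  regroup : ∀ s n → (n + s) + (+ 0 + (n + (n + + 0))) ≡ s + (n + (n + n))
  regroup = solve-∀

first-passage-area : ∀ (g : List Step → ℤ) w →
  ∑D-splits (λ q p → 𝟙ℳ q * g p) w * area 1 w
    ≡ ∑D-splits (λ q p → 𝟙ℳ q * area 1 q * g p) w + ∑D-splits (λ q p → 𝟙ℳ q * (g p * area 0 p)) w
first-passage-area g w =
  trans (∑D-splits-*ʳ w (λ q p → 𝟙ℳ q * g p) (area 1))
        (trans (∑D-splits-cong w split-area) (∑D-splits-+ w _ _))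
  where
  open ≡-Reasoning
  swap : ∀ m g a → m * g * a ≡ g * (m * a)
  swap = solve-∀
  expand : ∀ m g a b → g * (m * (a + b)) ≡ m * a * g + m * (g * b)
  expand = solve-∀
  split-area : ∀ q p → 𝟙ℳ q * g p * area 1 (q ++ D ∷ p) ≡ 𝟙ℳ q * area 1 q * g p + 𝟙ℳ q * (g p * area 0 p)
  split-area q p = begin
    𝟙ℳ q * g p * area 1 (q ++ D ∷ p)                  ≡⟨ swap (𝟙ℳ q) (g p) _ ⟩
    g p * (𝟙ℳ q * area 1 (q ++ D ∷ p))                ≡⟨ cong (g p *_) (area-++ 0 q p) ⟩
    g p * (𝟙ℳ q * (area 1 q + area 0 p))              ≡⟨ expand (𝟙ℳ q) (g p) (area 1 q) (area 0 p) ⟩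
    𝟙ℳ q * area 1 q * g p + 𝟙ℳ q * (g p * area 0 p)  ∎

first-step-𝟙ℳ-area : ∀ w →
  ∑prepend (λ v → 𝟙ℳ v * area 0 v) w
    ≡ ∑D-splits (λ q p → 𝟙ℳ q * area 1 q * 𝟙ℳ p) w + ∑D-splits (λ q p → 𝟙ℳ q * (𝟙ℳ p * area 0 p)) w
      + (𝟙ℳ w * area 0 w + 𝟙ℳ w * area 0 w)
first-step-𝟙ℳ-area w = begin
  motzkinInd 1 w * (+ 0 + area 1 w) + rest
    ≡⟨ cong (λ z → z * (+ 0 + area 1 w) + rest) (motzkinInd-1 w) ⟩
  splits * (+ 0 + area 1 w) + rest
    ≡⟨ regroup splits (area 1 w) (𝟙ℳ w) (area 0 w) ⟩
  splits * area 1 w + (𝟙ℳ w * area 0 w + 𝟙ℳ w * area 0 w)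
    ≡⟨ cong (_+ (𝟙ℳ w * area 0 w + 𝟙ℳ w * area 0 w)) (first-passage-area 𝟙ℳ w) ⟩
  ∑D-splits (λ q p → 𝟙ℳ q * area 1 q * 𝟙ℳ p) w + ∑D-splits (λ q p → 𝟙ℳ q * (𝟙ℳ p * area 0 p)) w
    + (𝟙ℳ w * area 0 w + 𝟙ℳ w * area 0 w) ∎
  where
  open ≡-Reasoning
  splits rest : ℤ
  splits = ∑D-splits (λ q p → 𝟙ℳ q * 𝟙ℳ p) w
  rest   = + 0 + (𝟙ℳ w * (+ 0 + area 0 w) + (𝟙ℳ w * (+ 0 + area 0 w) + + 0))
  regroup : ∀ s a₁ m a₀ → s * (+ 0 + a₁) + (+ 0 + (m * (+ 0 + a₀) + (m * (+ 0 + a₀) + + 0)))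
                         ≡ s * a₁ + (m * a₀ + m * a₀)
  regroup = solve-∀

first-step-𝟙𝒩-area : ∀ w →
  ∑prepend (λ v → 𝟙𝒩 v * area 0 v) w
    ≡ ∑D-splits (λ q p → 𝟙ℳ q * area 1 q * 𝟙𝒩 p) w + ∑D-splits (λ q p → 𝟙ℳ q * (𝟙𝒩 p * area 0 p)) w
      + + suc (length w) * 𝟙𝒩 w + (𝟙𝒩 w * area 0 w + (𝟙𝒩 w * area 0 w + 𝟙𝒩 w * area 0 w))
first-step-𝟙𝒩-area w = begin
  nonnegInd 1 w * (+ 0 + area 1 w) + rest
    ≡⟨ cong (λ z → z * (+ 0 + area 1 w) + rest) (nonnegWeight-first-passage (λ _ → + 1) 0 w) ⟩
  (𝟙𝒩 w + splits) * (+ 0 + area 1 w) + rest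
    ≡⟨ regroup₁ (𝟙𝒩 w) splits (area 1 w) (area 0 w) ⟩
  splits * area 1 w + 𝟙𝒩 w * area 1 w + (𝟙𝒩 w * area 0 w + 𝟙𝒩 w * area 0 w)
    ≡⟨ cong₂ (λ u v → u + v + (𝟙𝒩 w * area 0 w + 𝟙𝒩 w * area 0 w))
             (first-passage-area 𝟙𝒩 w) (area-suc (λ _ → + 1) 0 w) ⟩
  S₁ + S₂ + 𝟙𝒩 w * (area 0 w + + suc (length w)) + (𝟙𝒩 w * area 0 w + 𝟙𝒩 w * area 0 w)
    ≡⟨ regroup₂ S₁ S₂ (𝟙𝒩 w) (area 0 w) (+ suc (length w)) ⟩
  S₁ + S₂ + + suc (length w) * 𝟙𝒩 w + (𝟙𝒩 w * area 0 w + (𝟙𝒩 w * area 0 w + 𝟙𝒩 w * area 0 w)) ∎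
  where
  open ≡-Reasoning
  splits S₁ S₂ rest : ℤ
  splits = ∑D-splits (λ q p → 𝟙ℳ q * 𝟙𝒩 p) w
  S₁     = ∑D-splits (λ q p → 𝟙ℳ q * area 1 q * 𝟙𝒩 p) w
  S₂     = ∑D-splits (λ q p → 𝟙ℳ q * (𝟙𝒩 p * area 0 p)) w
  rest   = + 0 + (𝟙𝒩 w * (+ 0 + area 0 w) + (𝟙𝒩 w * (+ 0 + area 0 w) + + 0))
  regroup₁ : ∀ n s a₁ a₀ → (n + s) * (+ 0 + a₁) + (+ 0 + (n * (+ 0 + a₀) + (n * (+ 0 + a₀) + + 0)))
                          ≡ s * a₁ + n * a₁ + (n * a₀ + n * a₀)
  regroup₁ = solve-∀
  regroup₂ : ∀ s₁ s₂ n a₀ L → s₁ + s₂ + n * (a₀ + L) + (n * a₀ + n * a₀)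
                             ≡ s₁ + s₂ + L * n + (n * a₀ + (n * a₀ + n * a₀))
  regroup₂ = solve-∀

raised-𝐌-IsGF : IsGF (𝐌gf ⊕ ∂ (X* ℳgf)) (λ q → 𝟙ℳ q * area 1 q)
raised-𝐌-IsGF = IsGF-weight area₁ (IsGF-⊕ 𝐌gf-IsGF (IsGF-length ℳgf-IsGF))
  where
  area₁ : ∀ q → 𝟙ℳ q * area 0 q + + suc (length q) * 𝟙ℳ q ≡ 𝟙ℳ q * area 1 q
  area₁ q = sym (trans (area-suc isZero 0 q)
                       (trans (ℤP.*-distribˡ-+ (𝟙ℳ q) _ _)
                              (cong (_+_ (𝟙ℳ q * area 0 q)) (ℤP.*-comm (𝟙ℳ q) _))))

ℳ-recurrence : ℳgf ≈ₛ 1ₛ ⊕ x ⊛ (x ⊛ (ℳgf ⊛ ℳgf) ⊕ (ℳgf ⊕ ℳgf))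
ℳ-recurrence = IsGF-unique ℳgf-IsGF
  (IsGF-∑prepend 𝟙ℳ (IsGF-weight (sym ∘ first-step-𝟙ℳ)
    (IsGF-⊕ (IsGF-∑D-splits ℳgf-IsGF ℳgf-IsGF) (IsGF-⊕ ℳgf-IsGF ℳgf-IsGF))))

𝒩-recurrence : 𝒩gf ≈ₛ 1ₛ ⊕ x ⊛ (x ⊛ (ℳgf ⊛ 𝒩gf) ⊕ (𝒩gf ⊕ (𝒩gf ⊕ 𝒩gf)))
𝒩-recurrence = IsGF-unique 𝒩gf-IsGF
  (IsGF-∑prepend 𝟙𝒩 (IsGF-weight (sym ∘ first-step-𝟙𝒩)
    (IsGF-⊕ (IsGF-∑D-splits ℳgf-IsGF 𝒩gf-IsGF) (IsGF-⊕ 𝒩gf-IsGF (IsGF-⊕ 𝒩gf-IsGF 𝒩gf-IsGF)))))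

𝐌-recurrence :
  𝐌gf ≈ₛ const (+ 0) ⊕ x ⊛ (x ⊛ ((𝐌gf ⊕ ∂ (X* ℳgf)) ⊛ ℳgf) ⊕ x ⊛ (ℳgf ⊛ 𝐌gf) ⊕ (𝐌gf ⊕ 𝐌gf))
𝐌-recurrence = IsGF-unique 𝐌gf-IsGF
  (IsGF-∑prepend (λ w → 𝟙ℳ w * area 0 w) (IsGF-weight (sym ∘ first-step-𝟙ℳ-area)
    (IsGF-⊕ (IsGF-⊕ (IsGF-∑D-splits raised-𝐌-IsGF ℳgf-IsGF) (IsGF-∑D-splits ℳgf-IsGF 𝐌gf-IsGF))
            (IsGF-⊕ 𝐌gf-IsGF 𝐌gf-IsGF))))

𝐍-recurrence :
  𝐍gf ≈ₛ const (+ 0) ⊕ x ⊛ (x ⊛ ((𝐌gf ⊕ ∂ (X* ℳgf)) ⊛ 𝒩gf) ⊕ x ⊛ (ℳgf ⊛ 𝐍gf) ⊕ ∂ (X* 𝒩gf)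
                          ⊕ (𝐍gf ⊕ (𝐍gf ⊕ 𝐍gf)))
𝐍-recurrence = IsGF-unique 𝐍gf-IsGF
  (IsGF-∑prepend (λ w → 𝟙𝒩 w * area 0 w) (IsGF-weight (sym ∘ first-step-𝟙𝒩-area)
    (IsGF-⊕ (IsGF-⊕ (IsGF-⊕ (IsGF-∑D-splits raised-𝐌-IsGF 𝒩gf-IsGF)
                            (IsGF-∑D-splits ℳgf-IsGF 𝐍gf-IsGF))
                    (IsGF-length 𝒩gf-IsGF))
            (IsGF-⊕ 𝐍gf-IsGF (IsGF-⊕ 𝐍gf-IsGF 𝐍gf-IsGF)))))

-- The closed form

module ClosedForm (S : Series) (S₀≡1 : S 0 ≡ + 1) (S²≈ : S ⊛ S ≈ₛ 1ₛ ⊕ -ₛ (const (+ 4) ⊛ x)) where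

  P : Series
  P = S ⊛ (1ₛ ⊕ S)

  ℳ-closed-form : const (+ 2) ⊛ (x ⊛ (x ⊛ ℳgf)) ≈ₛ 1ₛ ⊕ -ₛ (const (+ 2) ⊛ x) ⊕ -ₛ S
  ℳ-closed-form = ≈-modulo 1ₛ a≈-S (solve 3 (λ x S M →
      con (+ 2) :* (x :* (x :* M))
    := con (+ 1) :- con (+ 2) :* x :- S
       :+ con (+ 1) :* (con (+ 2) :* (x :* (x :* M)) :+ con (+ 2) :* x :- con (+ 1) :- :- S))
    ≈ₛ-refl x S ℳgf)
    where
    a : Series
    a = const (+ 2) ⊛ (x ⊛ (x ⊛ ℳgf)) ⊕ const (+ 2) ⊛ x ⊕ -ₛ 1ₛ
    a²≈S² : a ⊛ a ≈ₛ S ⊛ S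
    a²≈S² = ≈-modulo (-ₛ (const (+ 4) ⊛ (x ⊛ x))) ℳ-recurrence (≈-modulo (-ₛ 1ₛ) S²≈ (solve 3 (λ x S M →
        (con (+ 2) :* (x :* (x :* M)) :+ con (+ 2) :* x :- con (+ 1))
          :* (con (+ 2) :* (x :* (x :* M)) :+ con (+ 2) :* x :- con (+ 1))
      := S :* S
         :+ (:- (con (+ 4) :* (x :* x))) :* (M :- (con (+ 1) :+ x :* (x :* (M :* M) :+ (M :+ M))))
         :+ (:- con (+ 1)) :* (S :* S :- (con (+ 1) :- con (+ 4) :* x)))
      ≈ₛ-refl x S ℳgf))
    -- The constant terms −1 of a and 1 of S select the sign of the square root.
    a≈-S : a ≈ₛ -ₛ S
    a≈-S = a²≈b²⇒a≈-b a²≈S² (λ a₀≡S₀ → contradiction (trans a₀≡S₀ S₀≡1) λ ())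

  𝒩-closed-form : 𝒩gf ⊛ P ≈ₛ const (+ 2)
  𝒩-closed-form =
    ≈-modulo 𝒩gf S²≈ (≈-modulo (const (+ 2)) 𝒩-recurrence (≈-modulo 𝒩gf ℳ-closed-form (solve 4 (λ x S M N →
      N :* (S :* (con (+ 1) :+ S))
    := con (+ 2)
       :+ N :* (S :* S :- (con (+ 1) :- con (+ 4) :* x))
       :+ con (+ 2) :* (N :- (con (+ 1) :+ x :* (x :* (M :* N) :+ (N :+ (N :+ N)))))
       :+ N :* (con (+ 2) :* (x :* (x :* M)) :- (con (+ 1) :- con (+ 2) :* x :- S)))
    ≈ₛ-refl x S ℳgf 𝒩gf)))

  S⊛θS : S ⊛ θ S ≈ₛ -ₛ (const (+ 2) ⊛ x)
  S⊛θS = ⊛-cancelˡ {const (+ 2)} (λ ()) (≈-modulo 1ₛ θ[S²≈] (solve 3 (λ x S θS →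
      con (+ 2) :* (S :* θS)
    := con (+ 2) :* (:- (con (+ 2) :* x))
       :+ con (+ 1) :* (θS :* S :+ S :* θS :- (con (+ 0) :- (con (+ 0) :* x :+ con (+ 4) :* x))))
    ≈ₛ-refl x S (θ S)))
    where
    θ[S²≈] : θ S ⊛ S ⊕ S ⊛ θ S ≈ₛ const (+ 0) ⊕ -ₛ (const (+ 0) ⊛ x ⊕ const (+ 4) ⊛ x)
    θ[S²≈] = θ-both S²≈ (θ-⊛ {S} {S} ≈ₛ-refl ≈ₛ-refl) (θ-⊕ (θ-const (+ 1)) (θ--ₛ (θ-⊛ (θ-const (+ 4)) θ-x)))

  ∂xℳ-closed-form : const (+ 2) ⊛ (x ⊛ (x ⊛ ∂ (X* ℳgf))) ≈ₛ S ⊕ -ₛ 1ₛ ⊕ -ₛ θ S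
  ∂xℳ-closed-form =
    ≈-modulo 1ₛ θ[ℳ-closed-form] (≈-modulo (-ₛ 1ₛ) ℳ-closed-form
      (≈-modulo (const (+ 2) ⊛ (x ⊛ x)) (∂X*-as-θ⊕ ℳgf)
      (solve 6 (λ x S θS M θM DM →
          con (+ 2) :* (x :* (x :* DM))
        := S :- con (+ 1) :- θS
           :+ con (+ 1) :* (con (+ 0) :* (x :* (x :* M))
                              :+ con (+ 2) :* (x :* (x :* M) :+ x :* (x :* M :+ x :* θM))
                            :- (con (+ 0) :- (con (+ 0) :* x :+ con (+ 2) :* x) :- θS))
           :+ (:- con (+ 1)) :* (con (+ 2) :* (x :* (x :* M)) :- (con (+ 1) :- con (+ 2) :* x :- S))
           :+ con (+ 2) :* (x :* x) :* (DM :- (θM :+ M)))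
      ≈ₛ-refl x S (θ S) ℳgf (θ ℳgf) (∂ (X* ℳgf)))))
    where
    θ[ℳ-closed-form] :
      const (+ 0) ⊛ (x ⊛ (x ⊛ ℳgf)) ⊕ const (+ 2) ⊛ (x ⊛ (x ⊛ ℳgf) ⊕ x ⊛ (x ⊛ ℳgf ⊕ x ⊛ θ ℳgf))
        ≈ₛ const (+ 0) ⊕ -ₛ (const (+ 0) ⊛ x ⊕ const (+ 2) ⊛ x) ⊕ -ₛ θ S
    θ[ℳ-closed-form] = θ-both ℳ-closed-form
      (θ-⊛ (θ-const (+ 2)) (θ-⊛ θ-x (θ-⊛ {x} {ℳgf} θ-x ≈ₛ-refl)))
      (θ-⊕ (θ-⊕ (θ-const (+ 1)) (θ--ₛ (θ-⊛ (θ-const (+ 2)) θ-x))) (θ--ₛ {S} ≈ₛ-refl))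

  𝐌-closed-form : 𝐌gf ⊛ S ≈ₛ x ⊛ (x ⊛ (ℳgf ⊛ ∂ (X* ℳgf)))
  𝐌-closed-form = ≈-modulo 1ₛ 𝐌-recurrence (≈-modulo 𝐌gf ℳ-closed-form (solve 5 (λ x S M 𝐌 DM →
      𝐌 :* S
    := x :* (x :* (M :* DM))
       :+ con (+ 1) :* (𝐌 :- (con (+ 0) :+ x :* (x :* ((𝐌 :+ DM) :* M) :+ x :* (M :* 𝐌) :+ (𝐌 :+ 𝐌))))
       :+ 𝐌 :* (con (+ 2) :* (x :* (x :* M)) :- (con (+ 1) :- con (+ 2) :* x :- S)))
    ≈ₛ-refl x S ℳgf 𝐌gf (∂ (X* ℳgf))))

  𝐍-linear-equation :
    𝐍gf ⊛ P
      ≈ₛ const (+ 2) ⊛ (x ⊛ (x ⊛ (𝐌gf ⊛ 𝒩gf))) ⊕ const (+ 2) ⊛ (x ⊛ (x ⊛ (𝒩gf ⊛ ∂ (X* ℳgf))))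
         ⊕ const (+ 2) ⊛ (x ⊛ ∂ (X* 𝒩gf))
  𝐍-linear-equation =
    ≈-modulo (const (+ 2)) 𝐍-recurrence (≈-modulo 𝐍gf S²≈ (≈-modulo 𝐍gf ℳ-closed-form
      (solve 8 (λ x S M N 𝐌 𝐍 DM DN →
        𝐍 :* (S :* (con (+ 1) :+ S))
      := con (+ 2) :* (x :* (x :* (𝐌 :* N))) :+ con (+ 2) :* (x :* (x :* (N :* DM))) :+ con (+ 2) :* (x :* DN)
         :+ con (+ 2) :* (𝐍 :- (con (+ 0) :+ x :* (x :* ((𝐌 :+ DM) :* N) :+ x :* (M :* 𝐍) :+ DN :+ (𝐍 :+ (𝐍 :+ 𝐍)))))
         :+ 𝐍 :* (S :* S :- (con (+ 1) :- con (+ 4) :* x))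
         :+ 𝐍 :* (con (+ 2) :* (x :* (x :* M)) :- (con (+ 1) :- con (+ 2) :* x :- S)))
      ≈ₛ-refl x S ℳgf 𝒩gf 𝐌gf 𝐍gf (∂ (X* ℳgf)) (∂ (X* 𝒩gf)))))

  ∂x𝒩-closed-form : S ⊛ P ⊛ P ⊛ ∂ (X* 𝒩gf) ≈ₛ const (+ 2) ⊛ (1ₛ ⊕ -ₛ (const (+ 2) ⊛ x) ⊕ S)
  ∂x𝒩-closed-form =
    ≈-modulo (S ⊛ P) θ[𝒩-closed-form] (≈-modulo (S ⊛ P ⊕ -ₛ (S ⊛ (θ S ⊛ (1ₛ ⊕ S) ⊕ S ⊛ θ S))) 𝒩-closed-form
      (≈-modulo (-ₛ (const (+ 2) ⊛ (1ₛ ⊕ const (+ 2) ⊛ S))) S⊛θS (≈-modulo (const (+ 2) ⊛ (1ₛ ⊕ S)) S²≈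
        (≈-modulo (S ⊛ P ⊛ P) (∂X*-as-θ⊕ 𝒩gf) (solve 6 (λ x S θS N θN DN →
            S :* (S :* (con (+ 1) :+ S)) :* (S :* (con (+ 1) :+ S)) :* DN
          := con (+ 2) :* (con (+ 1) :- con (+ 2) :* x :+ S)
             :+ S :* (S :* (con (+ 1) :+ S))
                :* (θN :* (S :* (con (+ 1) :+ S)) :+ N :* (θS :* (con (+ 1) :+ S) :+ S :* (con (+ 0) :+ θS))
                    :- con (+ 0))
             :+ (S :* (S :* (con (+ 1) :+ S)) :- S :* (θS :* (con (+ 1) :+ S) :+ S :* θS))
                :* (N :* (S :* (con (+ 1) :+ S)) :- con (+ 2))
             :+ (:- (con (+ 2) :* (con (+ 1) :+ con (+ 2) :* S))) :* (S :* θS :- :- (con (+ 2) :* x))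
             :+ con (+ 2) :* (con (+ 1) :+ S) :* (S :* S :- (con (+ 1) :- con (+ 4) :* x))
             :+ S :* (S :* (con (+ 1) :+ S)) :* (S :* (con (+ 1) :+ S)) :* (DN :- (θN :+ N)))
          ≈ₛ-refl x S (θ S) 𝒩gf (θ 𝒩gf) (∂ (X* 𝒩gf)))))))
    where
    θ[𝒩-closed-form] : θ 𝒩gf ⊛ P ⊕ 𝒩gf ⊛ (θ S ⊛ (1ₛ ⊕ S) ⊕ S ⊛ (const (+ 0) ⊕ θ S)) ≈ₛ const (+ 0)
    θ[𝒩-closed-form] = θ-both 𝒩-closed-form
      (θ-⊛ {𝒩gf} ≈ₛ-refl (θ-⊛ {S} ≈ₛ-refl (θ-⊕ (θ-const (+ 1)) ≈ₛ-refl)))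
      (θ-const (+ 2))

  𝐌-terms-closed-form :
    const (+ 2) ⊛ (x ⊛ (x ⊛ (𝐌gf ⊛ 𝒩gf ⊕ 𝒩gf ⊛ ∂ (X* ℳgf)))) ⊛ S ⊛ P ⊛ P ≈ₛ const (+ 4) ⊛ (x ⊛ (x ⊛ (1ₛ ⊕ S)))
  𝐌-terms-closed-form =
    ≈-modulo (const (+ 2) ⊛ (x ⊛ x) ⊛ (𝐌gf ⊛ S ⊕ ∂ (X* ℳgf) ⊛ S) ⊛ P) 𝒩-closed-form
      (≈-modulo (const (+ 4) ⊛ (x ⊛ x) ⊛ P) 𝐌-closed-form
        (≈-modulo (const (+ 2) ⊛ (x ⊛ x) ⊛ ∂ (X* ℳgf) ⊛ P) ℳ-closed-form (≈-modulo 1ₛ ∂xℳ-part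
          (solve 6 (λ x S M N 𝐌 DM →
              con (+ 2) :* (x :* (x :* (𝐌 :* N :+ N :* DM))) :* S :* (S :* (con (+ 1) :+ S)) :* (S :* (con (+ 1) :+ S))
            := con (+ 4) :* (x :* (x :* (con (+ 1) :+ S)))
               :+ con (+ 2) :* (x :* x) :* (𝐌 :* S :+ DM :* S) :* (S :* (con (+ 1) :+ S))
                  :* (N :* (S :* (con (+ 1) :+ S)) :- con (+ 2))
               :+ con (+ 4) :* (x :* x) :* (S :* (con (+ 1) :+ S)) :* (𝐌 :* S :- x :* (x :* (M :* DM)))
               :+ con (+ 2) :* (x :* x) :* DM :* (S :* (con (+ 1) :+ S))
                  :* (con (+ 2) :* (x :* (x :* M)) :- (con (+ 1) :- con (+ 2) :* x :- S))
               :+ con (+ 1) :* (con (+ 2) :* (x :* (x :* DM)) :* (S :* (con (+ 1) :+ S)) :* (con (+ 1) :- con (+ 2) :* x :+ S)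
                                :- con (+ 4) :* (x :* (x :* (con (+ 1) :+ S)))))
          ≈ₛ-refl x S ℳgf 𝒩gf 𝐌gf (∂ (X* ℳgf))))))
    where
    ∂xℳ-part : const (+ 2) ⊛ (x ⊛ (x ⊛ ∂ (X* ℳgf))) ⊛ P ⊛ (1ₛ ⊕ -ₛ (const (+ 2) ⊛ x) ⊕ S)
                 ≈ₛ const (+ 4) ⊛ (x ⊛ (x ⊛ (1ₛ ⊕ S)))
    ∂xℳ-part =
      ≈-modulo ((1ₛ ⊕ S) ⊛ (S ⊕ -ₛ (const (+ 2) ⊛ x))) S²≈
        (≈-modulo (-ₛ ((1ₛ ⊕ S) ⊛ (1ₛ ⊕ -ₛ (const (+ 2) ⊛ x) ⊕ S))) S⊛θS
          (≈-modulo (P ⊛ (1ₛ ⊕ -ₛ (const (+ 2) ⊛ x) ⊕ S)) ∂xℳ-closed-form (solve 4 (λ x S θS DM →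
              con (+ 2) :* (x :* (x :* DM)) :* (S :* (con (+ 1) :+ S)) :* (con (+ 1) :- con (+ 2) :* x :+ S)
            := con (+ 4) :* (x :* (x :* (con (+ 1) :+ S)))
               :+ (con (+ 1) :+ S) :* (S :- con (+ 2) :* x) :* (S :* S :- (con (+ 1) :- con (+ 4) :* x))
               :+ (:- ((con (+ 1) :+ S) :* (con (+ 1) :- con (+ 2) :* x :+ S))) :* (S :* θS :- :- (con (+ 2) :* x))
               :+ S :* (con (+ 1) :+ S) :* (con (+ 1) :- con (+ 2) :* x :+ S)
                  :* (con (+ 2) :* (x :* (x :* DM)) :- (S :- con (+ 1) :- θS)))
            ≈ₛ-refl x S (θ S) (∂ (X* ℳgf)))))

  𝐍-closed-form : 𝐍gf ⊛ S ⊛ P ⊛ P ⊛ P ≈ₛ const (+ 4) ⊛ (x ⊛ (1ₛ ⊕ S ⊕ -ₛ (x ⊛ (1ₛ ⊕ -ₛ S))))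
  𝐍-closed-form =
    ≈-modulo (S ⊛ P ⊛ P) 𝐍-linear-equation
      (≈-modulo 1ₛ 𝐌-terms-closed-form (≈-modulo (const (+ 2) ⊛ x) ∂x𝒩-closed-form
      (solve 8 (λ x S M N 𝐌 𝐍 DM DN →
          𝐍 :* S :* (S :* (con (+ 1) :+ S)) :* (S :* (con (+ 1) :+ S)) :* (S :* (con (+ 1) :+ S))
        := con (+ 4) :* (x :* (con (+ 1) :+ S :- x :* (con (+ 1) :- S)))
           :+ S :* (S :* (con (+ 1) :+ S)) :* (S :* (con (+ 1) :+ S))
              :* (𝐍 :* (S :* (con (+ 1) :+ S))
                  :- (con (+ 2) :* (x :* (x :* (𝐌 :* N))) :+ con (+ 2) :* (x :* (x :* (N :* DM)))
                      :+ con (+ 2) :* (x :* DN)))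
           :+ con (+ 1) :* (con (+ 2) :* (x :* (x :* (𝐌 :* N :+ N :* DM))) :* S :* (S :* (con (+ 1) :+ S))
                              :* (S :* (con (+ 1) :+ S))
                            :- con (+ 4) :* (x :* (x :* (con (+ 1) :+ S))))
           :+ con (+ 2) :* x :* (S :* (S :* (con (+ 1) :+ S)) :* (S :* (con (+ 1) :+ S)) :* DN
                                 :- con (+ 2) :* (con (+ 1) :- con (+ 2) :* x :+ S)))
      ≈ₛ-refl x S ℳgf 𝒩gf 𝐌gf 𝐍gf (∂ (X* ℳgf)) (∂ (X* 𝒩gf)))))

𝐍-functional-equation :
  𝐍gf ≈ₛ ((+ 2) ·ₛ X* 𝐍gf) ⊕ (X* (X* (𝐌gf ⊛ 𝒩gf))) ⊕ (X* (X* (ℳgf ⊛ 𝐍gf)))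
         ⊕ (X* (X* (𝒩gf ⊛ ∂ (X* ℳgf)))) ⊕ X* 𝐍gf ⊕ X* (∂ (X* 𝒩gf))
𝐍-functional-equation = begin
  𝐍gf
    ≈⟨ 𝐍-recurrence ⟩
  const (+ 0) ⊕ x ⊛ (x ⊛ ((𝐌gf ⊕ ∂ (X* ℳgf)) ⊛ 𝒩gf) ⊕ x ⊛ (ℳgf ⊛ 𝐍gf) ⊕ ∂ (X* 𝒩gf) ⊕ (𝐍gf ⊕ (𝐍gf ⊕ 𝐍gf)))
    ≈⟨ solve 7 (λ x M N 𝐌 𝐍 DM DN →
           con (+ 0) :+ x :* (x :* ((𝐌 :+ DM) :* N) :+ x :* (M :* 𝐍) :+ DN :+ (𝐍 :+ (𝐍 :+ 𝐍)))
         := con (+ 2) :* (x :* 𝐍) :+ x :* (x :* (𝐌 :* N)) :+ x :* (x :* (M :* 𝐍)) :+ x :* (x :* (N :* DM))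
            :+ x :* 𝐍 :+ x :* DN)
         ≈ₛ-refl x ℳgf 𝒩gf 𝐌gf 𝐍gf (∂ (X* ℳgf)) (∂ (X* 𝒩gf)) ⟩
  const (+ 2) ⊛ (x ⊛ 𝐍gf) ⊕ x ⊛ (x ⊛ (𝐌gf ⊛ 𝒩gf)) ⊕ x ⊛ (x ⊛ (ℳgf ⊛ 𝐍gf)) ⊕ x ⊛ (x ⊛ (𝒩gf ⊛ ∂ (X* ℳgf)))
    ⊕ x ⊛ 𝐍gf ⊕ x ⊛ ∂ (X* 𝒩gf)
    ≈⟨ ⊕-cong (⊕-cong (⊕-cong (⊕-cong (⊕-cong (·ₛX*-as-const⊛x⊛ (+ 2) 𝐍gf) (X*X*-as-x⊛x⊛ (𝐌gf ⊛ 𝒩gf)))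
                                       (X*X*-as-x⊛x⊛ (ℳgf ⊛ 𝐍gf)))
                               (X*X*-as-x⊛x⊛ (𝒩gf ⊛ ∂ (X* ℳgf))))
                       (X*-as-x⊛ 𝐍gf))
               (X*-as-x⊛ (∂ (X* 𝒩gf))) ⟨
  ((+ 2) ·ₛ X* 𝐍gf) ⊕ (X* (X* (𝐌gf ⊛ 𝒩gf))) ⊕ (X* (X* (ℳgf ⊛ 𝐍gf)))
    ⊕ (X* (X* (𝒩gf ⊛ ∂ (X* ℳgf)))) ⊕ X* 𝐍gf ⊕ X* (∂ (X* 𝒩gf)) ∎
  where open SetoidReasoning ≈ₛ-setoid

𝐍-explicit-formula :
  (S : Series) → S 0 ≡ + 1 → (S ⊛ S ≈ₛ const (+ 1) ⊖ ((+ 4) ·ₛ X* (const (+ 1))))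
  → 𝐍gf ⊛ S ⊛ (const (+ 1) ⊖ ((+ 4) ·ₛ X* (const (+ 1))) ⊕ S)
            ⊛ (const (+ 1) ⊖ ((+ 4) ·ₛ X* (const (+ 1))) ⊕ S)
            ⊛ (const (+ 1) ⊖ ((+ 4) ·ₛ X* (const (+ 1))) ⊕ S)
    ≈ₛ (+ 4) ·ₛ X* (const (+ 1) ⊕ S ⊖ X* (const (+ 1) ⊖ S))
𝐍-explicit-formula S S₀≡1 S²≈1-4x = begin
  𝐍gf ⊛ S ⊛ Q ⊛ Q ⊛ Q
    ≈⟨ ⊛-cong (⊛-cong (⊛-cong {𝐍gf ⊛ S} ≈ₛ-refl Q≈P) Q≈P) Q≈P ⟩
  𝐍gf ⊛ S ⊛ P ⊛ P ⊛ P
    ≈⟨ 𝐍-closed-form ⟩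
  const (+ 4) ⊛ (x ⊛ (1ₛ ⊕ S ⊕ -ₛ (x ⊛ (1ₛ ⊕ -ₛ S))))
    ≈⟨ (λ n → trans (·ₛX*-as-const⊛x⊛ (+ 4) _ n) (⊛-cong {const (+ 4)} ≈ₛ-refl (⊛-cong {x} ≈ₛ-refl
         (λ m → cong (λ z → const (+ 1) m + S m + - z) (X*-as-x⊛ (const (+ 1) ⊖ S) m))) n)) ⟨
  (+ 4) ·ₛ X* (const (+ 1) ⊕ S ⊖ X* (const (+ 1) ⊖ S)) ∎
  where
  open SetoidReasoning ≈ₛ-setoid
  open ClosedForm S S₀≡1 (λ n → trans (S²≈1-4x n) (cong (λ z → const (+ 1) n + - z) (sym (const-⊛ (+ 4) x n))))
    using (P; 𝐍-closed-form)
  Q : Series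
  Q = const (+ 1) ⊖ ((+ 4) ·ₛ X* (const (+ 1))) ⊕ S
  Q≈P : Q ≈ₛ P
  Q≈P n = trans (cong (_+ S n) (sym (S²≈1-4x n)))
                (solve 1 (λ S → S :* S :+ S := S :* (con (+ 1) :+ S)) ≈ₛ-refl S n)

proposition6p2 :
    (𝐍gf ≈ₛ ((+ 2) ·ₛ X* 𝐍gf) ⊕ (X* (X* (𝐌gf ⊛ 𝒩gf))) ⊕ (X* (X* (ℳgf ⊛ 𝐍gf)))
              ⊕ (X* (X* (𝒩gf ⊛ ∂ (X* ℳgf)))) ⊕ X* 𝐍gf ⊕ X* (∂ (X* 𝒩gf)))
    × ((S : Series) → S 0 ≡ + 1 → (S ⊛ S ≈ₛ const (+ 1) ⊖ ((+ 4) ·ₛ X* (const (+ 1))))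
       → 𝐍gf ⊛ S ⊛ (const (+ 1) ⊖ ((+ 4) ·ₛ X* (const (+ 1))) ⊕ S)
                 ⊛ (const (+ 1) ⊖ ((+ 4) ·ₛ X* (const (+ 1))) ⊕ S)
                 ⊛ (const (+ 1) ⊖ ((+ 4) ·ₛ X* (const (+ 1))) ⊕ S)
         ≈ₛ (+ 4) ·ₛ X* (const (+ 1) ⊕ S ⊖ X* (const (+ 1) ⊖ S)))
proposition6p2 = 𝐍-functional-equation , 𝐍-explicit-formula
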